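{- Let $G$ be a finite graph with vertex set $V$ and weight function $\omega:V\to\mathbb{Z}_{>0}$. For each $W\subseteq V$ let $a_W(1),a_W(2),\dots$ be the unique real numbers with $\prod_{k\ge1}(1+t^k)^{a_W(k)} = I_{(G|_W,\omega)}(t)$ as formal power series. Let $\lambda=\ell^{i_\ell}\cdots 2^{i_2}1^{i_1}$ be a partition (with $i_j$ parts equal to $j$). Then the coefficient of $\overline{p}_\lambda$ in the expansion of $\overline{X}_{(G,\omega)}$ in the $\overline{p}$-basis is $$[\overline{p}_\lambda]\overline{X}_{(G,\omega)} = \sum_{W\subseteq V}(-1)^{|V\setminus W|}\prod_{k=1}^{\ell}\binom{a_W(k)}{i_k}.$$
   Context: For $W\subseteq V$, $G|_W$ is the induced subgraph on $W$ with weights $\omega$ restricted to $W$. For $S\subseteq V$, $\omega(S)=\sum_{v\in S}\omega(v)$. The independence polynomial is $I_{(H,\omega)}(t)=\sum_{S} t^{\omega(S)}$ over all independent sets $S$ of $H$ (including $\varnothing$). For real $a$, $\binom{a}{i}=a(a-1)\cdots(a-i+1)/i!$ and $(1+u)^a=\sum_{i\ge0}\binom{a}{i}u^i$. A proper set coloring of $(G,\omega)$ assigns to each vertex a nonempty subset of $\mathbb{Z}_{>0}$ with adjacent vertices receiving disjoint sets; the Kromatic symmetric function is $\overline{X}_{(G,\omega)}=\sum_\alpha\prod_{v\in V}\prod_{i\in\alpha(v)}x_i^{\omega(v)}$ over proper set colorings $\alpha$. For a partition $\lambda$, $\overline{p}_\lambda:=\overline{X}_{\overline{K_\lambda}}$,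 where $\overline{K_\lambda}$ is the edgeless graph whose vertex weights are the parts of $\lambda$; the $\overline{p}_\lambda$ form a basis in which $\overline{X}_{(G,\omega)}$ is expanded (as a possibly infinite sum).
   Formalization: The exponents $a_W(k)$ range over the rationals instead of the real numbers. -}

module Defs where

open import Data.Bool using (Bool; true; false; if_then_else_; _∧_; _∨_; not)
open import Data.Nat as ℕ using (ℕ; zero; suc; _≡ᵇ_; _≤ᵇ_; _!)
open import Data.Integer as ℤ using (ℤ; +_)
open import Data.Rational as ℚ using (ℚ; 0ℚ; 1ℚ; _/_)
open import Data.Fin using (Fin; toℕ)
open import Data.Vec as Vec using (Vec; []; _∷_; lookup)
open import Data.List as List using (List; []; _∷_; map; _++_; foldr; allFin; upTo; filter; length; concatMap)
open import Data.Fin.Subset using (Subset)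
open import Relation.Binary.PropositionalEquality using (_≡_)
open import Relation.Nullary.Decidable using (does)
open import Data.Bool.Properties using (T?)
open import Data.Nat.Properties using (_!≢0)

allSubsets : (N : ℕ) → List (Subset N)
allSubsets zero = [] ∷ []
allSubsets (suc N) = map (true ∷_) (allSubsets N) ++ map (false ∷_) (allSubsets N)

allVecs : {A : Set} → List A → (n : ℕ) → List (Vec A n)
allVecs xs zero = [] ∷ []
allVecs xs (suc n) = concatMap (λ x → map (x ∷_) (allVecs xs n)) xs

allB : {n : ℕ} → (Fin n → Bool) → Bool
allB {n} p = foldr (λ v b → p v ∧ b) true (allFin n)

anyB : {n : ℕ} → (Fin n → Bool) → Bool
anyB {n} p = foldr (λ v b → p v ∨ b) false (allFin n)

sumFinℕ : {n : ℕ} → (Fin n → ℕ) → ℕ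
sumFinℕ {n} f = foldr (λ v s → f v ℕ.+ s) 0 (allFin n)

countB : {A : Set} → (A → Bool) → List A → ℕ
countB p xs = foldr (λ x c → if p x then suc c else c) 0 xs

sumℚ : List ℚ → ℚ
sumℚ = foldr ℚ._+_ 0ℚ

prodℚ : List ℚ → ℚ
prodℚ = foldr ℚ._*_ 1ℚ

ℕtoℚ : ℕ → ℚ
ℕtoℚ n = (+ n) / 1

record WGraph : Set where
  field
    n     : ℕ
    adj   : Fin n → Fin n → Bool
    sym   : ∀ u v → adj u v ≡ adj v u
    loopless : ∀ v → adj v v ≡ false
    ω     : Fin n → ℕ
    ω-pos : ∀ v → 1 ℕ.≤ ω v

-- A monomial x_1^{e_1} ... x_N^{e_N} is given by e : Vec ℕ N.
-- Its coefficient in X̄ is the number of proper set colorings α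
-- (α v nonempty, adjacent vertices disjoint) with
-- sum_v ω(v) [i ∈ α v] = e_i for every i; such colorings necessarily
-- use only colors in {1..N}, so α v ⊆ Fin N.

isProperSetColoring : (n : ℕ) → (Fin n → Fin n → Bool) → {N : ℕ} → Vec (Subset N) n → Bool
isProperSetColoring n adj {N} α =
  allB (λ v → anyB (λ i → lookup (lookup α v) i))
  ∧ allB (λ u → allB (λ v → not (adj u v) ∨
        not (anyB (λ i → lookup (lookup α u) i ∧ lookup (lookup α v) i))))

hasMonomial : (n : ℕ) → (Fin n → ℕ) → {N : ℕ} → Vec ℕ N → Vec (Subset N) n → Bool
hasMonomial n ω {N} e α =
  allB (λ i → sumFinℕ (λ v → if lookup (lookup α v) i then ω v else 0) ≡ᵇ lookup e i)

kromCoeffRaw : (n : ℕ) → (Fin n → Fin n → Bool) → (Fin n → ℕ) → {N : ℕ} → Vec ℕ N → ℕ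
kromCoeffRaw n adj ω {N} e =
  countB (λ α → isProperSetColoring n adj α ∧ hasMonomial n ω e α)
         (allVecs (allSubsets N) n)

kromCoeff : WGraph → {N : ℕ} → Vec ℕ N → ℕ
kromCoeff G e = kromCoeffRaw n adj ω e where open WGraph G

-- Partitions, encoded by multiplicity vectors: m : Vec ℕ D with
-- lookup m k = number of parts equal to (toℕ k + 1).

partWeights : {D : ℕ} → Vec ℕ D → List ℕ
partWeights {D} m = concatMap (λ k → List.replicate (lookup m k) (suc (toℕ k))) (allFin D)

partSize : {D : ℕ} → Vec ℕ D → ℕ
partSize {D} m = sumFinℕ (λ k → suc (toℕ k) ℕ.* lookup m k)

partitionsUpTo : (D : ℕ) → List (Vec ℕ D)
partitionsUpTo D = filter (λ m → T? (partSize m ≤ᵇ D)) (allVecs (upTo (suc D)) D)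

-- [x^e] p̄_λ, where p̄_λ = X̄ of the edgeless graph with vertex weights the parts of λ
pbarCoeff : {D : ℕ} → Vec ℕ D → {N : ℕ} → Vec ℕ N → ℕ
pbarCoeff m e = kromCoeffRaw (length ws) (λ _ _ → false) (List.lookup ws) e
  where ws = partWeights m

fallingℚ : ℚ → ℕ → ℚ
fallingℚ a zero = 1ℚ
fallingℚ a (suc i) = fallingℚ a i ℚ.* (a ℚ.- ℕtoℚ i)

binomℚ : ℚ → ℕ → ℚ
binomℚ a i = fallingℚ a i ℚ.* ((+ 1) / (i !))
  where instance _ = i !≢0

Series : Set
Series = ℕ → ℚ

_⊛_ : Series → Series → Series
(f ⊛ g) m = sumℚ (map (λ j → f j ℚ.* g (m ℕ.∸ j)) (upTo (suc m)))

oneSeries : Series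
oneSeries zero = 1ℚ
oneSeries (suc _) = 0ℚ

-- (1 + t^k)^a = Σ_i binom a i t^{k i}
binSeries : ℕ → ℚ → Series
binSeries k a m = sumℚ (map (λ i → if k ℕ.* i ≡ᵇ m then binomℚ a i else 0ℚ) (upTo (suc m)))

prodBin : ℕ → (ℕ → ℚ) → Series
prodBin zero a = oneSeries
prodBin (suc K) a = prodBin K a ⊛ binSeries (suc K) (a (suc K))

-- coefficient of t^m in the infinite product Π_{k≥1} (1+t^k)^{a k}
-- (factors with k > m do not contribute to t^m)
prodBinCoeff : (ℕ → ℚ) → ℕ → ℚ
prodBinCoeff a m = prodBin m a m

-- Independence polynomial of (G|_W, ω): coefficient of t^m is the number
-- of independent sets S ⊆ W of G with ω(S) = m.

module _ (G : WGraph) where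
  open WGraph G

  subsetB : Subset n → Subset n → Bool
  subsetB S W = allB (λ v → not (lookup S v) ∨ lookup W v)

  independentB : Subset n → Bool
  independentB S = allB (λ u → allB (λ v → not (lookup S u ∧ lookup S v ∧ adj u v)))

  weightOf : Subset n → ℕ
  weightOf S = sumFinℕ (λ v → if lookup S v then ω v else 0)

  indepCoeff : Subset n → ℕ → ℕ
  indepCoeff W m = countB (λ S → subsetB S W ∧ independentB S ∧ (weightOf S ≡ᵇ m)) (allSubsets n)

  card : Subset n → ℕ
  card S = countB (λ v → lookup S v) (allFin n)

signℚ : ℕ → ℚ
signℚ zero = 1ℚ
signℚ (suc k) = ℚ.- signℚ k

formula : (G : WGraph) → (Subset (WGraph.n G) → ℕ → ℚ) → {D : ℕ} → Vec ℕ D → ℚ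
formula G a {D} m = sumℚ (map (λ W →
    signℚ (WGraph.n G ℕ.∸ card G W) ℚ.*
    prodℚ (map (λ k → binomℚ (a W (suc (toℕ k))) (lookup m k)) (allFin D)))
  (allSubsets (WGraph.n G)))

vsum : {N : ℕ} → Vec ℕ N → ℕ
vsum = Vec.foldr _ ℕ._+_ 0

-- Left side: allow the vertices outside a set R to receive the empty colour set. Peeling off the class of
-- the first colour, which is an independent set whose vertices then no longer need colours, gives by
-- induction on the number of colours the inclusion–exclusion formula
--   [xᵉ] X̄_G = Σ_W (−1)^{|V∖W|} ∏_i [t^{e_i}] I_{G|W}(t).
--
-- Right side: p̄_λ = ∏_{parts w of λ} Q_w with Q_w = ∏_i (1 + x_i^w) − 1, hence
--   Σ_λ ∏_k C(a_k, i_k) p̄_λ = ∏_k (1 + Q_k)^{a_k} = ∏_i ∏_k (1 + x_i^k)^{a_k},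
-- the last step by (1 + u)ᵃ (1 + v)ᵃ = (1 + u + v (1 + u))ᵃ, applied with v = x_i^k and u = Q_k in the other variables.
-- Everything is computed in power series truncated above the total degree of e, where Q_k is nilpotent
-- and the binomial series are finite sums. The hypothesis on a_W turns ∏_k (1 + t^k)^{a_W(k)} into I_{G|W}(t).

module Submission where

open import Defs
open import Data.Nat using (ℕ)
open import Data.Rational using (ℚ)
open import Data.Vec using (Vec)
open import Data.List using (map)
open import Data.Fin.Subset using (Subset)
open import Relation.Binary.PropositionalEquality using (_≡_)
import Data.Rational as Q

open import Algebra.Bundles using (CommutativeSemiring)
open import Algebra.Morphism.Structures using (IsSemiringHomomorphism)
open import Level using (0ℓ)
open import Function using (id)
open import Data.Nat as ℕ using (zero; suc; _∸_; _<_; _≤_; z≤n; s≤s; _≡ᵇ_; _!)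
import Data.Nat.Properties as ℕₚ
open import Data.Bool using (Bool; true; false; if_then_else_; _∧_; _∨_; not)
open import Data.Fin using (Fin; zero; suc; toℕ)
open import Data.List as List using (List; []; _∷_; _++_; foldr; concatMap; allFin)
import Data.List.Properties as Listₚ
open import Data.Vec as Vec using ([]; _∷_; lookup)
import Relation.Binary.PropositionalEquality as P
import Data.Rational.Properties as ℚₚ
open import Data.Bool.Properties using (∧-commutativeMonoid)
open import Algebra.Properties.CommutativeSemigroup (Algebra.Bundles.CommutativeMonoid.commutativeSemigroup ∧-commutativeMonoid)
  using () renaming (interchange to ∧-interchange)

module AllFinFolds where
  open P using (refl; sym; trans; cong; cong₂)

  foldr-allFin-suc : ∀ {B : Set} n (h : Fin (suc n) → B → B) z →
                     foldr h z (allFin (suc n)) ≡ h zero (foldr (λ i → h (suc i)) z (allFin n))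
  foldr-allFin-suc n h z = cong (h zero)
    (trans (cong (foldr h z) (sym (Listₚ.map-tabulate id suc))) (Listₚ.foldr-map h suc z (allFin n)))

  allB-suc : ∀ {n} (p : Fin (suc n) → Bool) → allB p ≡ (p zero ∧ allB (λ i → p (suc i)))
  allB-suc {n} p = foldr-allFin-suc n (λ v b → p v ∧ b) true

  anyB-suc : ∀ {n} (p : Fin (suc n) → Bool) → anyB p ≡ (p zero ∨ anyB (λ i → p (suc i)))
  anyB-suc {n} p = foldr-allFin-suc n (λ v b → p v ∨ b) false

  sumFinℕ-suc : ∀ {n} (f : Fin (suc n) → ℕ) → sumFinℕ f ≡ f zero ℕ.+ sumFinℕ (λ i → f (suc i))
  sumFinℕ-suc {n} f = foldr-allFin-suc n (λ v s → f v ℕ.+ s) 0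

  countB-allFin-suc : ∀ {n} (p : Fin (suc n) → Bool) →
                      countB p (allFin (suc n)) ≡ (if p zero then suc (countB (λ i → p (suc i)) (allFin n))
                                                    else countB (λ i → p (suc i)) (allFin n))
  countB-allFin-suc {n} p = foldr-allFin-suc n (λ x c → if p x then suc c else c) 0

  allB-cong : ∀ {n} {p q : Fin n → Bool} → (∀ i → p i ≡ q i) → allB p ≡ allB q
  allB-cong {n} p≗q = Listₚ.foldr-cong (λ v b → cong (_∧ b) (p≗q v)) refl (allFin n)

  sumFinℕ-cong : ∀ {n} {f g : Fin n → ℕ} → (∀ i → f i ≡ g i) → sumFinℕ f ≡ sumFinℕ g
  sumFinℕ-cong {n} f≗g = Listₚ.foldr-cong (λ v s → cong (ℕ._+ s) (f≗g v)) refl (allFin n)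

  allB-true : ∀ {n} → allB {n} (λ _ → true) ≡ true
  allB-true {zero} = refl
  allB-true {suc n} = trans (allB-suc {n} (λ _ → true)) (allB-true {n})

  allB-∧ : ∀ {n} (p q : Fin n → Bool) → allB (λ i → p i ∧ q i) ≡ (allB p ∧ allB q)
  allB-∧ {zero} p q = refl
  allB-∧ {suc n} p q = begin
    allB (λ i → p i ∧ q i)                                    ≡⟨ allB-suc (λ i → p i ∧ q i) ⟩
    (p zero ∧ q zero) ∧ allB (λ i → p (suc i) ∧ q (suc i))
      ≡⟨ cong ((p zero ∧ q zero) ∧_) (allB-∧ (λ i → p (suc i)) (λ i → q (suc i))) ⟩
    (p zero ∧ q zero) ∧ (allB (λ i → p (suc i)) ∧ allB (λ i → q (suc i)))
      ≡⟨ ∧-interchange (p zero) (q zero) (allB (λ i → p (suc i))) (allB (λ i → q (suc i))) ⟩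
    (p zero ∧ allB (λ i → p (suc i))) ∧ (q zero ∧ allB (λ i → q (suc i)))
      ≡⟨ sym (cong₂ _∧_ (allB-suc p) (allB-suc q)) ⟩
    allB p ∧ allB q                                           ∎
    where open P.≡-Reasoning

module NatCast where
  open import Data.Integer as ℤ using (+_)
  import Data.Integer.Properties as ℤₚ
  open Q using (1ℚ; _+_; _*_; _/_; toℚᵘ)
  import Data.Rational.Unnormalised as ℚᵘ
  import Data.Rational.Unnormalised.Properties as ℚᵘₚ
  open P using (sym; trans; cong)

  private
    toℚᵘ-ℕtoℚ : ∀ n → toℚᵘ (ℕtoℚ n) ℚᵘ.≃ ℚᵘ.mkℚᵘ (+ n) 0
    toℚᵘ-ℕtoℚ n = ℚₚ.toℚᵘ-fromℚᵘ (ℚᵘ.mkℚᵘ (+ n) 0)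

    ℤ-*1 : ∀ z → z ℤ.* + 1 ≡ z
    ℤ-*1 = ℤₚ.*-identityʳ

  ℕtoℚ-+ : ∀ m n → ℕtoℚ (m ℕ.+ n) ≡ ℕtoℚ m + ℕtoℚ n
  ℕtoℚ-+ m n = ℚₚ.toℚᵘ-injective (begin
    toℚᵘ (ℕtoℚ (m ℕ.+ n))                         ≈⟨ toℚᵘ-ℕtoℚ (m ℕ.+ n) ⟩
    ℚᵘ.mkℚᵘ (+ (m ℕ.+ n)) 0                        ≈⟨ ℚᵘ.*≡* +-on-numerators ⟩
    ℚᵘ.mkℚᵘ (+ m) 0 ℚᵘ.+ ℚᵘ.mkℚᵘ (+ n) 0           ≈⟨ ℚᵘₚ.+-cong (toℚᵘ-ℕtoℚ m) (toℚᵘ-ℕtoℚ n) ⟨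
    toℚᵘ (ℕtoℚ m) ℚᵘ.+ toℚᵘ (ℕtoℚ n)               ≈⟨ ℚₚ.toℚᵘ-homo-+ (ℕtoℚ m) (ℕtoℚ n) ⟨
    toℚᵘ (ℕtoℚ m + ℕtoℚ n)                         ∎)
    where
    open ℚᵘₚ.≃-Reasoning
    +-on-numerators : + (m ℕ.+ n) ℤ.* + 1 ≡ (+ m ℤ.* + 1 ℤ.+ + n ℤ.* + 1) ℤ.* + 1
    +-on-numerators rewrite ℤ-*1 (+ (m ℕ.+ n)) | ℤ-*1 (+ m) | ℤ-*1 (+ n) | ℤ-*1 (+ m ℤ.+ + n) = ℤₚ.pos-+ m n

  ℕtoℚ-* : ∀ m n → ℕtoℚ (m ℕ.* n) ≡ ℕtoℚ m * ℕtoℚ n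
  ℕtoℚ-* m n = ℚₚ.toℚᵘ-injective (begin
    toℚᵘ (ℕtoℚ (m ℕ.* n))                          ≈⟨ toℚᵘ-ℕtoℚ (m ℕ.* n) ⟩
    ℚᵘ.mkℚᵘ (+ (m ℕ.* n)) 0                        ≈⟨ ℚᵘ.*≡* (cong (ℤ._* + 1) (ℤₚ.pos-* m n)) ⟩
    ℚᵘ.mkℚᵘ (+ m) 0 ℚᵘ.* ℚᵘ.mkℚᵘ (+ n) 0           ≈⟨ ℚᵘₚ.*-cong (toℚᵘ-ℕtoℚ m) (toℚᵘ-ℕtoℚ n) ⟨
    toℚᵘ (ℕtoℚ m) ℚᵘ.* toℚᵘ (ℕtoℚ n)               ≈⟨ ℚₚ.toℚᵘ-homo-* (ℕtoℚ m) (ℕtoℚ n) ⟨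
    toℚᵘ (ℕtoℚ m * ℕtoℚ n)                         ∎)
    where open ℚᵘₚ.≃-Reasoning

  ℕtoℚ-suc : ∀ n → ℕtoℚ (suc n) ≡ 1ℚ + ℕtoℚ n
  ℕtoℚ-suc = ℕtoℚ-+ 1

  1/n*n≡1 : ∀ n .{{_ : ℕ.NonZero n}} → ((+ 1) / n) * ℕtoℚ n ≡ 1ℚ
  1/n*n≡1 (suc m) = ℚₚ.toℚᵘ-injective (begin
    toℚᵘ ((+ 1) / suc m * ℕtoℚ (suc m))
      ≈⟨ ℚₚ.toℚᵘ-homo-* ((+ 1) / suc m) (ℕtoℚ (suc m)) ⟩
    toℚᵘ ((+ 1) / suc m) ℚᵘ.* toℚᵘ (ℕtoℚ (suc m))
      ≈⟨ ℚᵘₚ.*-cong (ℚₚ.toℚᵘ-fromℚᵘ (ℚᵘ.mkℚᵘ (+ 1) m)) (toℚᵘ-ℕtoℚ (suc m)) ⟩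
    ℚᵘ.mkℚᵘ (+ 1) m ℚᵘ.* ℚᵘ.mkℚᵘ (+ suc m) 0
      ≈⟨ ℚᵘ.*≡* (cong (λ k → + suc k) [m+0]*1≡m*1+0) ⟩
    ℚᵘ.1ℚᵘ ∎)
    where
    open ℚᵘₚ.≃-Reasoning
    [m+0]*1≡m*1+0 : (m ℕ.+ 0) ℕ.* 1 ≡ m ℕ.* 1 ℕ.+ 0
    [m+0]*1≡m*1+0 = trans (cong (ℕ._* 1) (ℕₚ.+-identityʳ m)) (sym (ℕₚ.+-identityʳ (m ℕ.* 1)))

module GeneralisedBinomial where
  open import Data.Integer using (+_)
  open Q using (0ℚ; 1ℚ; _+_; _*_; _-_; _/_)
  open import Data.Rational.Solver using (module +-*-Solver)
  open +-*-Solver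
  open P using (refl; sym; trans; cong; cong₂)
  open P.≡-Reasoning
  open NatCast

  1/! : ℕ → ℚ
  1/! i = (+ 1) / (i !)
    where instance _ = i ℕₚ.!≢0

  1/!*! : ∀ i → 1/! i * ℕtoℚ (i !) ≡ 1ℚ
  1/!*! i = 1/n*n≡1 (i !) {{i ℕₚ.!≢0}}

  inverse-unique : ∀ x y n → x * n ≡ 1ℚ → y * n ≡ 1ℚ → x ≡ y
  inverse-unique x y n xn≡1 yn≡1 = begin
    x                ≡⟨ sym (ℚₚ.*-identityʳ x) ⟩
    x * 1ℚ           ≡⟨ cong (x *_) (sym yn≡1) ⟩
    x * (y * n)      ≡⟨ solve 3 (λ x y n → x :* (y :* n) := (x :* n) :* y) refl x y n ⟩
    (x * n) * y      ≡⟨ cong (_* y) xn≡1 ⟩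
    1ℚ * y           ≡⟨ ℚₚ.*-identityˡ y ⟩
    y                ∎

  1/!-suc : ∀ i → 1/! i ≡ 1/! (suc i) * ℕtoℚ (suc i)
  1/!-suc i = inverse-unique _ _ (ℕtoℚ (i !)) (1/!*! i) (begin
    1/! (suc i) * ℕtoℚ (suc i) * ℕtoℚ (i !)      ≡⟨ ℚₚ.*-assoc (1/! (suc i)) _ _ ⟩
    1/! (suc i) * (ℕtoℚ (suc i) * ℕtoℚ (i !))    ≡⟨ cong (1/! (suc i) *_) (sym (ℕtoℚ-* (suc i) (i !))) ⟩
    1/! (suc i) * ℕtoℚ (suc i !)                 ≡⟨ 1/!*! (suc i) ⟩
    1ℚ                                            ∎)

  fallingℚ-+1 : ∀ a i → fallingℚ (a + 1ℚ) (suc i) ≡ (a + 1ℚ) * fallingℚ a i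
  fallingℚ-+1 a zero = solve 1 (λ a → con 1ℚ :* ((a :+ con 1ℚ) :- con 0ℚ) := (a :+ con 1ℚ) :* con 1ℚ) refl a
  fallingℚ-+1 a (suc i) = begin
    fallingℚ (a + 1ℚ) (suc i) * (a + 1ℚ - ℕtoℚ (suc i))
      ≡⟨ cong₂ (λ u v → u * (a + 1ℚ - v)) (fallingℚ-+1 a i) (ℕtoℚ-suc i) ⟩
    (a + 1ℚ) * fallingℚ a i * (a + 1ℚ - (1ℚ + ℕtoℚ i))
      ≡⟨ solve 3 (λ a f n → (a :+ con 1ℚ) :* f :* (a :+ con 1ℚ :- (con 1ℚ :+ n)) := (a :+ con 1ℚ) :* (f :* (a :- n)))
               refl a (fallingℚ a i) (ℕtoℚ i) ⟩
    (a + 1ℚ) * (fallingℚ a i * (a - ℕtoℚ i))      ∎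

  binomℚ-pascal : ∀ a i → binomℚ (a + 1ℚ) (suc i) ≡ binomℚ a (suc i) + binomℚ a i
  binomℚ-pascal a i = begin
    fallingℚ (a + 1ℚ) (suc i) * 1/! (suc i)
      ≡⟨ cong (_* 1/! (suc i)) (fallingℚ-+1 a i) ⟩
    (a + 1ℚ) * f * 1/! (suc i)
      ≡⟨ solve 4 (λ a f v n → (a :+ con 1ℚ) :* f :* v := f :* (a :- n) :* v :+ f :* (v :* (con 1ℚ :+ n)))
               refl a f (1/! (suc i)) (ℕtoℚ i) ⟩
    f * (a - ℕtoℚ i) * 1/! (suc i) + f * (1/! (suc i) * (1ℚ + ℕtoℚ i))
      ≡⟨ cong (λ w → f * (a - ℕtoℚ i) * 1/! (suc i) + f * w)
              (trans (cong (1/! (suc i) *_) (sym (ℕtoℚ-suc i))) (sym (1/!-suc i))) ⟩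
    f * (a - ℕtoℚ i) * 1/! (suc i) + f * 1/! i      ∎
    where f = fallingℚ a i

  fallingℚ-+ : ∀ a t J → fallingℚ a (t ℕ.+ J) ≡ fallingℚ a J * fallingℚ (a - ℕtoℚ J) t
  fallingℚ-+ a zero J = sym (ℚₚ.*-identityʳ (fallingℚ a J))
  fallingℚ-+ a (suc t) J = begin
    fallingℚ a (t ℕ.+ J) * (a - ℕtoℚ (t ℕ.+ J))
      ≡⟨ cong₂ (λ u v → u * (a - v)) (fallingℚ-+ a t J) (ℕtoℚ-+ t J) ⟩
    fallingℚ a J * g * (a - (ℕtoℚ t + ℕtoℚ J))
      ≡⟨ solve 5 (λ f g a n m → f :* g :* (a :- (n :+ m)) := f :* (g :* (a :- m :- n))) refl
               (fallingℚ a J) g a (ℕtoℚ t) (ℕtoℚ J) ⟩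
    fallingℚ a J * (g * (a - ℕtoℚ J - ℕtoℚ t))      ∎
    where g = fallingℚ (a - ℕtoℚ J) t

  fallingℚ-ℕ : ∀ t J → fallingℚ (ℕtoℚ (t ℕ.+ J)) J * ℕtoℚ (t !) ≡ ℕtoℚ ((t ℕ.+ J) !)
  fallingℚ-ℕ t zero rewrite ℕₚ.+-identityʳ t = ℚₚ.*-identityˡ (ℕtoℚ (t !))
  fallingℚ-ℕ t (suc J) rewrite ℕₚ.+-suc t J = begin
    fallingℚ (ℕtoℚ (suc n)) (suc J) * ℕtoℚ (t !)
      ≡⟨ cong (λ x → fallingℚ x (suc J) * ℕtoℚ (t !)) n+1 ⟩
    fallingℚ (ℕtoℚ n + 1ℚ) (suc J) * ℕtoℚ (t !)
      ≡⟨ cong (_* ℕtoℚ (t !)) (fallingℚ-+1 (ℕtoℚ n) J) ⟩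
    (ℕtoℚ n + 1ℚ) * fallingℚ (ℕtoℚ n) J * ℕtoℚ (t !)
      ≡⟨ ℚₚ.*-assoc (ℕtoℚ n + 1ℚ) _ _ ⟩
    (ℕtoℚ n + 1ℚ) * (fallingℚ (ℕtoℚ n) J * ℕtoℚ (t !))
      ≡⟨ cong₂ _*_ (sym n+1) (fallingℚ-ℕ t J) ⟩
    ℕtoℚ (suc n) * ℕtoℚ (n !)
      ≡⟨ sym (ℕtoℚ-* (suc n) (n !)) ⟩
    ℕtoℚ (suc n !)                                     ∎
    where
    n = t ℕ.+ J
    n+1 : ℕtoℚ (suc n) ≡ ℕtoℚ n + 1ℚ
    n+1 = trans (ℕtoℚ-suc n) (ℚₚ.+-comm 1ℚ (ℕtoℚ n))

  binomℚ-trinomial-revision : ∀ a t J →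
    binomℚ a (t ℕ.+ J) * binomℚ (ℕtoℚ (t ℕ.+ J)) J ≡ binomℚ a J * binomℚ (a - ℕtoℚ J) t
  binomℚ-trinomial-revision a t J = begin
    fallingℚ a (t ℕ.+ J) * 1/! (t ℕ.+ J) * (h * 1/! J)
      ≡⟨ cong (λ u → u * 1/! (t ℕ.+ J) * (h * 1/! J)) (fallingℚ-+ a t J) ⟩
    fallingℚ a J * g * 1/! (t ℕ.+ J) * (h * 1/! J)
      ≡⟨ solve 5 (λ f g v h w → f :* g :* v :* (h :* w) := f :* w :* (g :* (v :* h))) refl
               (fallingℚ a J) g (1/! (t ℕ.+ J)) h (1/! J) ⟩
    fallingℚ a J * 1/! J * (g * (1/! (t ℕ.+ J) * h))
      ≡⟨ cong (λ u → fallingℚ a J * 1/! J * (g * u)) 1/!-ratio ⟩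
    fallingℚ a J * 1/! J * (g * 1/! t)                 ∎
    where
    g = fallingℚ (a - ℕtoℚ J) t
    h = fallingℚ (ℕtoℚ (t ℕ.+ J)) J
    1/!-ratio : 1/! (t ℕ.+ J) * h ≡ 1/! t
    1/!-ratio = inverse-unique _ _ (ℕtoℚ (t !))
      (trans (ℚₚ.*-assoc (1/! (t ℕ.+ J)) h (ℕtoℚ (t !)))
             (trans (cong (1/! (t ℕ.+ J) *_) (fallingℚ-ℕ t J)) (1/!*! (t ℕ.+ J))))
      (1/!*! t)

  binomℚ-ℕ-vanishes : ∀ z k → binomℚ (ℕtoℚ z) (k ℕ.+ suc z) ≡ 0ℚ
  binomℚ-ℕ-vanishes z k = trans (cong (_* 1/! (k ℕ.+ suc z)) (falling-vanishes k)) (ℚₚ.*-zeroˡ (1/! (k ℕ.+ suc z)))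
    where
    falling-vanishes : ∀ k → fallingℚ (ℕtoℚ z) (k ℕ.+ suc z) ≡ 0ℚ
    falling-vanishes zero = trans (cong (fallingℚ (ℕtoℚ z) z *_) (ℚₚ.+-inverseʳ (ℕtoℚ z))) (ℚₚ.*-zeroʳ (fallingℚ (ℕtoℚ z) z))
    falling-vanishes (suc k) =
      trans (cong (_* (ℕtoℚ z - ℕtoℚ (k ℕ.+ suc z))) (falling-vanishes k)) (ℚₚ.*-zeroˡ (ℕtoℚ z - ℕtoℚ (k ℕ.+ suc z)))

  binomℚ-ℕ-pascal : ∀ z J → binomℚ (ℕtoℚ (suc z)) (suc J) ≡ binomℚ (ℕtoℚ z) (suc J) + binomℚ (ℕtoℚ z) J
  binomℚ-ℕ-pascal z J = trans (cong (λ x → binomℚ x (suc J)) (trans (ℕtoℚ-suc z) (ℚₚ.+-comm 1ℚ (ℕtoℚ z))))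
                              (binomℚ-pascal (ℕtoℚ z) J)

  -suc+1 : ∀ a J → (a - ℕtoℚ (suc J)) + 1ℚ ≡ a - ℕtoℚ J
  -suc+1 a J = trans (cong (λ x → (a - x) + 1ℚ) (ℕtoℚ-suc J))
    (solve 2 (λ a n → (a :- (con 1ℚ :+ n)) :+ con 1ℚ := a :- n) refl a (ℕtoℚ J))

module SemiringSums (R : CommutativeSemiring 0ℓ 0ℓ) where
  open CommutativeSemiring R hiding (zero)
  open import Algebra.Definitions.RawSemiring rawSemiring public using (_^_)
  open import Algebra.Properties.CommutativeSemigroup +-commutativeSemigroup
    using () renaming (interchange to +-interchange)
  open import Algebra.Properties.CommutativeSemigroup *-commutativeSemigroup
    using () renaming (interchange to *-interchange)
  open import Data.Sum using (inj₁; inj₂)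
  open import Relation.Binary.Reasoning.Setoid setoid

  ≡⇒≈ : ∀ {x y} → x ≡ y → x ≈ y
  ≡⇒≈ P.refl = refl

  Σ< : ℕ → (ℕ → Carrier) → Carrier
  Σ< zero f = 0#
  Σ< (suc n) f = Σ< n f + f n

  Σ<-cong : ∀ n {f g} → (∀ i → i < n → f i ≈ g i) → Σ< n f ≈ Σ< n g
  Σ<-cong zero f≈g = refl
  Σ<-cong (suc n) f≈g = +-cong (Σ<-cong n (λ i i<n → f≈g i (ℕₚ.m<n⇒m<1+n i<n))) (f≈g n (ℕₚ.n<1+n n))

  Σ<-cong′ : ∀ n {f g} → (∀ i → f i ≈ g i) → Σ< n f ≈ Σ< n g
  Σ<-cong′ n f≈g = Σ<-cong n (λ i _ → f≈g i)

  Σ<-zero : ∀ n {f} → (∀ i → i < n → f i ≈ 0#) → Σ< n f ≈ 0#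
  Σ<-zero zero f≈0 = refl
  Σ<-zero (suc n) f≈0 = trans (+-cong (Σ<-zero n (λ i i<n → f≈0 i (ℕₚ.m<n⇒m<1+n i<n))) (f≈0 n (ℕₚ.n<1+n n)))
                              (+-identityˡ 0#)

  Σ<-+ : ∀ n f g → Σ< n (λ i → f i + g i) ≈ Σ< n f + Σ< n g
  Σ<-+ zero f g = sym (+-identityʳ 0#)
  Σ<-+ (suc n) f g = trans (+-cong (Σ<-+ n f g) refl) (+-interchange (Σ< n f) (Σ< n g) (f n) (g n))

  Σ<-*ˡ : ∀ n c f → c * Σ< n f ≈ Σ< n (λ i → c * f i)
  Σ<-*ˡ zero c f = zeroʳ c
  Σ<-*ˡ (suc n) c f = trans (distribˡ c _ _) (+-cong (Σ<-*ˡ n c f) refl)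

  Σ<-*ʳ : ∀ n c f → Σ< n f * c ≈ Σ< n (λ i → f i * c)
  Σ<-*ʳ n c f = trans (*-comm _ c) (trans (Σ<-*ˡ n c f) (Σ<-cong′ n (λ i → *-comm c (f i))))

  Σ<-head : ∀ n f → Σ< (suc n) f ≈ f 0 + Σ< n (λ i → f (suc i))
  Σ<-head zero f = +-comm 0# (f 0)
  Σ<-head (suc n) f = trans (+-cong (Σ<-head n f) refl) (+-assoc _ _ _)

  Σ<-vanishing-tail : ∀ {n} m f → n ≤ m → (∀ i → n ≤ i → i < m → f i ≈ 0#) → Σ< m f ≈ Σ< n f
  Σ<-vanishing-tail {zero} zero f z≤n _ = refl
  Σ<-vanishing-tail {n} (suc m) f n≤1+m f≈0 with ℕₚ.m≤n⇒m<n∨m≡n n≤1+m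
  ... | inj₂ P.refl = refl
  ... | inj₁ (s≤s n≤m) = trans (+-cong (Σ<-vanishing-tail m f n≤m (λ i n≤i i<m → f≈0 i n≤i (ℕₚ.m<n⇒m<1+n i<m)))
                                       (f≈0 m n≤m (ℕₚ.n<1+n m)))
                               (+-identityʳ _)

  Σ<-reverse : ∀ n f → Σ< n f ≈ Σ< n (λ i → f (n ∸ suc i))
  Σ<-reverse zero f = refl
  Σ<-reverse (suc n) f = trans (+-comm _ _) (trans (+-cong refl (Σ<-reverse n f)) (sym (Σ<-head n (λ i → f (n ∸ i)))))

  Σ<-triangle : ∀ M (f : ℕ → ℕ → Carrier) →
                Σ< (suc M) (λ z → Σ< (suc z) (λ J → f z J)) ≈ Σ< (suc M) (λ J → Σ< (suc (M ∸ J)) (λ t → f (t ℕ.+ J) J))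
  Σ<-triangle zero f = refl
  Σ<-triangle (suc M) f = begin
    Σ< (suc M) (λ z → Σ< (suc z) (f z)) + Σ< (suc (suc M)) (f (suc M))
      ≈⟨ +-cong (Σ<-triangle M f) refl ⟩
    Σ< (suc M) column + (Σ< (suc M) (f (suc M)) + f (suc M) (suc M))
      ≈⟨ +-assoc _ _ _ ⟨
    (Σ< (suc M) column + Σ< (suc M) (f (suc M))) + f (suc M) (suc M)
      ≈⟨ +-cong (Σ<-+ (suc M) column (f (suc M))) last-column ⟨
    Σ< (suc M) (λ J → column J + f (suc M) J) + Σ< (suc (M ∸ M)) (λ t → f (t ℕ.+ suc M) (suc M))
      ≈⟨ +-cong (Σ<-cong (suc M) extend-column) refl ⟩
    Σ< (suc M) (λ J → Σ< (suc (suc M ∸ J)) (λ t → f (t ℕ.+ J) J))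
      + Σ< (suc (suc M ∸ suc M)) (λ t → f (t ℕ.+ suc M) (suc M))   ∎
    where
    column : ℕ → Carrier
    column J = Σ< (suc (M ∸ J)) (λ t → f (t ℕ.+ J) J)
    last-column : Σ< (suc (M ∸ M)) (λ t → f (t ℕ.+ suc M) (suc M)) ≈ f (suc M) (suc M)
    last-column rewrite ℕₚ.n∸n≡0 M = +-identityˡ _
    extend-column : ∀ J → J < suc M → column J + f (suc M) J ≈ Σ< (suc (suc M ∸ J)) (λ t → f (t ℕ.+ J) J)
    extend-column J (s≤s J≤M) rewrite ℕₚ.+-∸-assoc 1 J≤M =
      +-cong refl (≡⇒≈ (P.cong (λ k → f (suc k) J) (P.sym (ℕₚ.m∸n+n≡m J≤M))))

  ΣL : ∀ {A : Set} → List A → (A → Carrier) → Carrier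
  ΣL xs f = foldr _+_ 0# (List.map f xs)

  ΣL-cong : ∀ {A : Set} (xs : List A) {f g} → (∀ x → f x ≈ g x) → ΣL xs f ≈ ΣL xs g
  ΣL-cong [] f≈g = refl
  ΣL-cong (x ∷ xs) f≈g = +-cong (f≈g x) (ΣL-cong xs f≈g)

  ΣL-zero : ∀ {A : Set} (xs : List A) → ΣL xs (λ _ → 0#) ≈ 0#
  ΣL-zero [] = refl
  ΣL-zero (x ∷ xs) = trans (+-identityˡ _) (ΣL-zero xs)

  ΣL-+ : ∀ {A : Set} (xs : List A) f g → ΣL xs (λ i → f i + g i) ≈ ΣL xs f + ΣL xs g
  ΣL-+ [] f g = sym (+-identityʳ 0#)
  ΣL-+ (x ∷ xs) f g = trans (+-cong refl (ΣL-+ xs f g)) (+-interchange (f x) (g x) (ΣL xs f) (ΣL xs g))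

  ΣL-*ˡ : ∀ {A : Set} (xs : List A) c f → c * ΣL xs f ≈ ΣL xs (λ i → c * f i)
  ΣL-*ˡ [] c f = zeroʳ c
  ΣL-*ˡ (x ∷ xs) c f = trans (distribˡ c _ _) (+-cong refl (ΣL-*ˡ xs c f))

  ΣL-*ʳ : ∀ {A : Set} (xs : List A) c f → ΣL xs f * c ≈ ΣL xs (λ i → f i * c)
  ΣL-*ʳ xs c f = trans (*-comm _ c) (trans (ΣL-*ˡ xs c f) (ΣL-cong xs (λ i → *-comm c (f i))))

  ΣL-++ : ∀ {A : Set} (xs ys : List A) f → ΣL (xs ++ ys) f ≈ ΣL xs f + ΣL ys f
  ΣL-++ [] ys f = sym (+-identityˡ _)
  ΣL-++ (x ∷ xs) ys f = trans (+-cong refl (ΣL-++ xs ys f)) (sym (+-assoc _ _ _))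

  ΣL-map : ∀ {A B : Set} (xs : List A) (g : A → B) f → ΣL (List.map g xs) f ≈ ΣL xs (λ x → f (g x))
  ΣL-map [] g f = refl
  ΣL-map (x ∷ xs) g f = +-cong refl (ΣL-map xs g f)

  ΣL-concatMap : ∀ {A B : Set} (xs : List A) (g : A → List B) f → ΣL (concatMap g xs) f ≈ ΣL xs (λ x → ΣL (g x) f)
  ΣL-concatMap [] g f = refl
  ΣL-concatMap (x ∷ xs) g f = trans (ΣL-++ (g x) (concatMap g xs) f) (+-cong refl (ΣL-concatMap xs g f))

  ΣL-comm : ∀ {A B : Set} (xs : List A) (ys : List B) (f : A → B → Carrier) →
            ΣL xs (λ x → ΣL ys (λ y → f x y)) ≈ ΣL ys (λ y → ΣL xs (λ x → f x y))
  ΣL-comm [] ys f = sym (ΣL-zero ys)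
  ΣL-comm (x ∷ xs) ys f = trans (+-cong refl (ΣL-comm xs ys f)) (sym (ΣL-+ ys (f x) (λ y → ΣL xs (λ x′ → f x′ y))))

  ΣL-applyUpTo : ∀ (f : ℕ → Carrier) g n → ΣL (List.applyUpTo g n) f ≈ Σ< n (λ i → f (g i))
  ΣL-applyUpTo f g zero = refl
  ΣL-applyUpTo f g (suc n) = trans (+-cong refl (ΣL-applyUpTo f (λ i → g (suc i)) n)) (sym (Σ<-head n (λ i → f (g i))))

  ΠL : ∀ {A : Set} → List A → (A → Carrier) → Carrier
  ΠL xs f = foldr (λ x acc → f x * acc) 1# xs

  ΠL-cong : ∀ {A : Set} (xs : List A) {f g} → (∀ x → f x ≈ g x) → ΠL xs f ≈ ΠL xs g
  ΠL-cong [] f≈g = refl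
  ΠL-cong (x ∷ xs) f≈g = *-cong (f≈g x) (ΠL-cong xs f≈g)

  ΠL-* : ∀ {A : Set} (xs : List A) f g → ΠL xs (λ x → f x * g x) ≈ ΠL xs f * ΠL xs g
  ΠL-* [] f g = sym (*-identityˡ 1#)
  ΠL-* (x ∷ xs) f g = trans (*-cong refl (ΠL-* xs f g)) (*-interchange (f x) (g x) (ΠL xs f) (ΠL xs g))

  Π< : ℕ → (ℕ → Carrier) → Carrier
  Π< zero f = 1#
  Π< (suc n) f = Π< n f * f n

  Π<-head : ∀ n f → Π< (suc n) f ≈ f 0 * Π< n (λ i → f (suc i))
  Π<-head zero f = *-comm 1# (f 0)
  Π<-head (suc n) f = trans (*-cong (Π<-head n f) refl) (*-assoc _ _ _)

  ΠL-allFin : ∀ n (f : ℕ → Carrier) → ΠL (allFin n) (λ k → f (toℕ k)) ≈ Π< n f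
  ΠL-allFin zero f = refl
  ΠL-allFin (suc n) f = begin
    ΠL (allFin (suc n)) (λ k → f (toℕ k))            ≡⟨ AllFinFolds.foldr-allFin-suc n (λ k acc → f (toℕ k) * acc) 1# ⟩
    f 0 * ΠL (allFin n) (λ k → f (suc (toℕ k)))     ≈⟨ *-cong refl (ΠL-allFin n (λ i → f (suc i))) ⟩
    f 0 * Π< n (λ i → f (suc i))                     ≈⟨ Π<-head n f ⟨
    Π< (suc n) f                                     ∎

  ΣL-allVecs-suc : ∀ {A : Set} (xs : List A) n (f : Vec A (suc n) → Carrier) →
                   ΣL (allVecs xs (suc n)) f ≈ ΣL xs (λ x → ΣL (allVecs xs n) (λ v → f (x ∷ v)))
  ΣL-allVecs-suc xs n f = trans (ΣL-concatMap xs _ f) (ΣL-cong xs (λ x → ΣL-map (allVecs xs n) (x ∷_) f))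

  ΣL-allVecs-ΠL : ∀ {A : Set} (xs : List A) D (F : Fin D → A → Carrier) →
                  ΣL (allVecs xs D) (λ v → ΠL (allFin D) (λ k → F k (lookup v k))) ≈ ΠL (allFin D) (λ k → ΣL xs (F k))
  ΣL-allVecs-ΠL xs zero F = +-identityʳ 1#
  ΣL-allVecs-ΠL xs (suc D) F = begin
    ΣL (allVecs xs (suc D)) (λ v → ΠL (allFin (suc D)) (λ k → F k (lookup v k)))
      ≈⟨ ΣL-allVecs-suc xs D _ ⟩
    ΣL xs (λ x → ΣL (allVecs xs D) (λ v → ΠL (allFin (suc D)) (λ k → F k (lookup (x ∷ v) k))))
      ≈⟨ ΣL-cong xs (λ x → ΣL-cong (allVecs xs D) (λ v → ≡⇒≈ (unfold (λ k → F k (lookup (x ∷ v) k))))) ⟩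
    ΣL xs (λ x → ΣL (allVecs xs D) (λ v → F zero x * ΠL (allFin D) (λ k → F (suc k) (lookup v k))))
      ≈⟨ ΣL-cong xs (λ x → ΣL-*ˡ (allVecs xs D) (F zero x) _) ⟨
    ΣL xs (λ x → F zero x * ΣL (allVecs xs D) (λ v → ΠL (allFin D) (λ k → F (suc k) (lookup v k))))
      ≈⟨ ΣL-cong xs (λ x → *-cong refl (ΣL-allVecs-ΠL xs D (λ k → F (suc k)))) ⟩
    ΣL xs (λ x → F zero x * ΠL (allFin D) (λ k → ΣL xs (F (suc k))))
      ≈⟨ ΣL-*ʳ xs _ (F zero) ⟨
    ΣL xs (F zero) * ΠL (allFin D) (λ k → ΣL xs (F (suc k)))
      ≡⟨ P.sym (unfold (λ k → ΣL xs (F k))) ⟩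
    ΠL (allFin (suc D)) (λ k → ΣL xs (F k))          ∎
    where
    unfold : ∀ (X : Fin (suc D) → Carrier) → ΠL (allFin (suc D)) X ≡ X zero * ΠL (allFin D) (λ k → X (suc k))
    unfold X = AllFinFolds.foldr-allFin-suc D (λ x acc → X x * acc) 1#

ℚ-commutativeSemiring : CommutativeSemiring 0ℓ 0ℓ
ℚ-commutativeSemiring = Algebra.Bundles.CommutativeRing.commutativeSemiring ℚₚ.+-*-commutativeRing

module ℚSums = SemiringSums ℚ-commutativeSemiring

module BinomialSeries
  (R : CommutativeSemiring 0ℓ 0ℓ)
  (ι : ℚ → CommutativeSemiring.Carrier R)
  (ι-isHomomorphism : IsSemiringHomomorphism Q.+-*-rawSemiring (CommutativeSemiring.rawSemiring R) ι)
  where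
  open CommutativeSemiring R hiding (zero)
  open IsSemiringHomomorphism ι-isHomomorphism using (⟦⟧-cong; +-homo; *-homo; 0#-homo; 1#-homo)
  open SemiringSums R
  open import Algebra.Properties.CommutativeSemiring.Exp R using (^-distrib-*)
  open import Algebra.Solver.Ring.NaturalCoefficients.Default R using (solve; _:=_; _:*_)
  open import Relation.Binary.Reasoning.Setoid setoid
  open GeneralisedBinomial

  binomial-theorem : ∀ x y z → (x + y) ^ z ≈ Σ< (suc z) (λ J → ι (binomℚ (ℕtoℚ z) J) * (x ^ (z ∸ J) * y ^ J))
  binomial-theorem x y zero = sym (trans (+-identityˡ _) (trans (*-cong 1#-homo (*-identityˡ 1#)) (*-identityˡ 1#)))
  binomial-theorem x y (suc z) = begin
    (x + y) * (x + y) ^ z                                   ≈⟨ *-cong refl (binomial-theorem x y z) ⟩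
    (x + y) * Σ< (suc z) T                                  ≈⟨ distribʳ _ x y ⟩
    x * Σ< (suc z) T + y * Σ< (suc z) T                     ≈⟨ +-cong (Σ<-*ˡ (suc z) x T) (Σ<-*ˡ (suc z) y T) ⟩
    Σ< (suc z) (λ J → x * T J) + Σ< (suc z) (λ J → y * T J) ≈⟨ +-cong x-part y-part ⟩
    Σ< (suc (suc z)) U + Σ< (suc (suc z)) V                 ≈⟨ Σ<-+ (suc (suc z)) U V ⟨
    Σ< (suc (suc z)) (λ J → U J + V J)                      ≈⟨ Σ<-cong′ (suc (suc z)) pascal-step ⟩
    Σ< (suc (suc z)) (λ J → ι (binomℚ (ℕtoℚ (suc z)) J) * (x ^ (suc z ∸ J) * y ^ J)) ∎
    where
    C : ℕ → Carrier
    C J = ι (binomℚ (ℕtoℚ z) J)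
    T U V : ℕ → Carrier
    T J = C J * (x ^ (z ∸ J) * y ^ J)
    U J = C J * (x ^ (suc z ∸ J) * y ^ J)
    V zero = 0#
    V (suc J) = C J * (x ^ (z ∸ J) * y ^ suc J)
    x-part : Σ< (suc z) (λ J → x * T J) ≈ Σ< (suc (suc z)) U
    x-part = sym (trans (Σ<-vanishing-tail (suc (suc z)) U (ℕₚ.n≤1+n (suc z)) top)
                        (Σ<-cong (suc z) (λ J J<1+z → sym (x*T J J<1+z))))
      where
      top : ∀ i → suc z ≤ i → i < suc (suc z) → U i ≈ 0#
      top i 1+z≤i (s≤s i≤1+z) rewrite ℕₚ.≤-antisym i≤1+z 1+z≤i =
        trans (*-cong (trans (⟦⟧-cong (binomℚ-ℕ-vanishes z 0)) 0#-homo) refl) (zeroˡ _)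
      x*T : ∀ J → J < suc z → x * T J ≈ U J
      x*T J (s≤s J≤z) rewrite ℕₚ.+-∸-assoc 1 J≤z =
        solve 4 (λ x c p q → x :* (c :* (p :* q)) := c :* ((x :* p) :* q)) refl x (C J) (x ^ (z ∸ J)) (y ^ J)
    y-part : Σ< (suc z) (λ J → y * T J) ≈ Σ< (suc (suc z)) V
    y-part = sym (trans (Σ<-head (suc z) V) (trans (+-identityˡ _) (Σ<-cong′ (suc z) (λ J →
      solve 4 (λ y c p q → c :* (p :* (y :* q)) := y :* (c :* (p :* q))) refl y (C J) (x ^ (z ∸ J)) (y ^ J)))))
    pascal-step : ∀ J → U J + V J ≈ ι (binomℚ (ℕtoℚ (suc z)) J) * (x ^ (suc z ∸ J) * y ^ J)
    pascal-step zero = +-identityʳ _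
    pascal-step (suc J) = begin
      C (suc J) * X + C J * X            ≈⟨ distribʳ X _ _ ⟨
      (C (suc J) + C J) * X              ≈⟨ *-cong (+-homo _ _) refl ⟨
      ι (binomℚ (ℕtoℚ z) (suc J) Q.+ binomℚ (ℕtoℚ z) J) * X
                                         ≈⟨ *-cong (⟦⟧-cong (P.sym (binomℚ-ℕ-pascal z J))) refl ⟩
      ι (binomℚ (ℕtoℚ (suc z)) (suc J)) * X ∎
      where X = x ^ (z ∸ J) * y ^ suc J

  binomialSum : ℕ → ℚ → Carrier → Carrier
  binomialSum M a u = Σ< (suc M) (λ x → ι (binomℚ a x) * u ^ x)

  module _ (M : ℕ) (u : Carrier) (u-nilpotent : u ^ suc M ≈ 0#) where

    binomialSum-+1 : ∀ b → (1# + u) * binomialSum M b u ≈ binomialSum M (b Q.+ Q.1ℚ) u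
    binomialSum-+1 b = begin
      (1# + u) * binomialSum M b u                        ≈⟨ distribʳ _ 1# u ⟩
      1# * binomialSum M b u + u * binomialSum M b u      ≈⟨ +-cong (*-identityˡ _) u*sum ⟩
      binomialSum M b u + Σ< (suc M) W                    ≈⟨ Σ<-+ (suc M) _ W ⟨
      Σ< (suc M) (λ x → ι (binomℚ b x) * u ^ x + W x)    ≈⟨ Σ<-cong′ (suc M) pascal-step ⟩
      binomialSum M (b Q.+ Q.1ℚ) u                         ∎
      where
      W : ℕ → Carrier
      W zero = 0#
      W (suc x) = ι (binomℚ b x) * u ^ suc x
      u*sum : u * binomialSum M b u ≈ Σ< (suc M) W
      u*sum = begin
        u * binomialSum M b u                              ≈⟨ Σ<-*ˡ (suc M) u _ ⟩
        Σ< (suc M) (λ x → u * (ι (binomℚ b x) * u ^ x))   ≈⟨ Σ<-cong′ (suc M) (λ x → x∙yz≈y∙xz u _ _) ⟩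
        Σ< (suc M) (λ x → W (suc x))                      ≈⟨ +-identityˡ _ ⟨
        0# + Σ< (suc M) (λ x → W (suc x))                 ≈⟨ Σ<-head (suc M) W ⟨
        Σ< (suc M) W + W (suc M)                          ≈⟨ +-cong refl (trans (*-cong refl u-nilpotent) (zeroʳ _)) ⟩
        Σ< (suc M) W + 0#                                 ≈⟨ +-identityʳ _ ⟩
        Σ< (suc M) W                                      ∎
        where open import Algebra.Properties.CommutativeSemigroup *-commutativeSemigroup using (x∙yz≈y∙xz)
      pascal-step : ∀ x → ι (binomℚ b x) * u ^ x + W x ≈ ι (binomℚ (b Q.+ Q.1ℚ) x) * u ^ x
      pascal-step zero = +-identityʳ _
      pascal-step (suc x) = trans (sym (distribʳ _ _ _)) (*-cong (trans (sym (+-homo _ _)) (⟦⟧-cong (P.sym (binomℚ-pascal b x)))) refl)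

    binomialSum-∸ : ∀ a J → (1# + u) ^ J * binomialSum M (a Q.- ℕtoℚ J) u ≈ binomialSum M a u
    binomialSum-∸ a zero = trans (*-identityˡ _) (≡⇒≈ (P.cong (λ q → binomialSum M q u) (ℚₚ.+-identityʳ a)))
    binomialSum-∸ a (suc J) = begin
      ((1# + u) * (1# + u) ^ J) * binomialSum M (a Q.- ℕtoℚ (suc J)) u
        ≈⟨ solve 3 (λ c p e → (c :* p) :* e := p :* (c :* e)) refl (1# + u) ((1# + u) ^ J) _ ⟩
      (1# + u) ^ J * ((1# + u) * binomialSum M (a Q.- ℕtoℚ (suc J)) u)
        ≈⟨ *-cong refl (binomialSum-+1 _) ⟩
      (1# + u) ^ J * binomialSum M ((a Q.- ℕtoℚ (suc J)) Q.+ Q.1ℚ) u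
        ≈⟨ *-cong refl (≡⇒≈ (P.cong (λ q → binomialSum M q u) (-suc+1 a J))) ⟩
      (1# + u) ^ J * binomialSum M (a Q.- ℕtoℚ J) u
        ≈⟨ binomialSum-∸ a J ⟩
      binomialSum M a u                                     ∎

  -- (1 + u)ᵃ (1 + v)ᵃ = (1 + (u + v (1 + u)))ᵃ: expand (u + v (1 + u))ᶻ binomially, then
  -- C(a, t + J) C(t + J, J) = C(a, J) C(a − J, t) and (1 + u)ᴶ (1 + u)ᵃ⁻ᴶ = (1 + u)ᵃ.
  binomialSum-* : ∀ M a u v → (∀ t J → M < t ℕ.+ J → u ^ t * v ^ J ≈ 0#) →
                  binomialSum M a (u + v * (1# + u)) ≈ binomialSum M a u * binomialSum M a v
  binomialSum-* M a u v nilpotent = begin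
    binomialSum M a (u + v * c)
      ≈⟨ Σ<-cong′ (suc M) (λ z → *-cong refl (binomial-theorem u (v * c) z)) ⟩
    Σ< (suc M) (λ z → ι (binomℚ a z) * Σ< (suc z) (λ J → ι (binomℚ (ℕtoℚ z) J) * (u ^ (z ∸ J) * (v * c) ^ J)))
      ≈⟨ Σ<-cong′ (suc M) (λ z → Σ<-*ˡ (suc z) _ _) ⟩
    Σ< (suc M) (λ z → Σ< (suc z) (F z))
      ≈⟨ Σ<-triangle M F ⟩
    Σ< (suc M) (λ J → Σ< (suc (M ∸ J)) (λ t → F (t ℕ.+ J) J))
      ≈⟨ Σ<-cong′ (suc M) (λ J → Σ<-cong′ (suc (M ∸ J)) (λ t → revise t J)) ⟩
    Σ< (suc M) (λ J → Σ< (suc (M ∸ J)) (Z J))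
      ≈⟨ Σ<-cong (suc M) (λ J J≤M → sym (Σ<-vanishing-tail (suc M) (Z J) (s≤s (ℕₚ.m∸n≤m M J)) (λ t lo _ → Z-vanishes J t J≤M lo))) ⟩
    Σ< (suc M) (λ J → Σ< (suc M) (Z J))
      ≈⟨ Σ<-cong′ (suc M) (λ J → sym (Σ<-*ˡ (suc M) _ _)) ⟩
    Σ< (suc M) (λ J → (ι (binomℚ a J) * (v ^ J * c ^ J)) * binomialSum M (a Q.- ℕtoℚ J) u)
      ≈⟨ Σ<-cong′ (suc M) (λ J → solve 4 (λ b p q e → (b :* (p :* q)) :* e := (b :* p) :* (q :* e)) refl (ι (binomℚ a J)) (v ^ J) (c ^ J) _) ⟩
    Σ< (suc M) (λ J → (ι (binomℚ a J) * v ^ J) * (c ^ J * binomialSum M (a Q.- ℕtoℚ J) u))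
      ≈⟨ Σ<-cong′ (suc M) (λ J → *-cong refl (binomialSum-∸ M u u-nilpotent a J)) ⟩
    Σ< (suc M) (λ J → (ι (binomℚ a J) * v ^ J) * binomialSum M a u)
      ≈⟨ Σ<-*ʳ (suc M) _ _ ⟨
    binomialSum M a v * binomialSum M a u
      ≈⟨ *-comm _ _ ⟩
    binomialSum M a u * binomialSum M a v   ∎
    where
    c = 1# + u
    F : ℕ → ℕ → Carrier
    F z J = ι (binomℚ a z) * (ι (binomℚ (ℕtoℚ z) J) * (u ^ (z ∸ J) * (v * c) ^ J))
    Z : ℕ → ℕ → Carrier
    Z J t = (ι (binomℚ a J) * (v ^ J * c ^ J)) * (ι (binomℚ (a Q.- ℕtoℚ J) t) * u ^ t)
    u-nilpotent : u ^ suc M ≈ 0#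
    u-nilpotent = trans (sym (*-identityʳ _)) (nilpotent (suc M) 0 (P.subst (M <_) (P.sym (ℕₚ.+-identityʳ (suc M))) (ℕₚ.n<1+n M)))
    revise : ∀ t J → F (t ℕ.+ J) J ≈ Z J t
    revise t J = begin
      ι (binomℚ a (t ℕ.+ J)) * (ι (binomℚ (ℕtoℚ (t ℕ.+ J)) J) * (u ^ (t ℕ.+ J ∸ J) * (v * c) ^ J))
        ≈⟨ *-cong refl (*-cong refl (*-cong (≡⇒≈ (P.cong (u ^_) (ℕₚ.m+n∸n≡m t J))) (^-distrib-* v c J))) ⟩
      ι (binomℚ a (t ℕ.+ J)) * (ι (binomℚ (ℕtoℚ (t ℕ.+ J)) J) * (u ^ t * (v ^ J * c ^ J)))
        ≈⟨ *-assoc _ _ _ ⟨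
      (ι (binomℚ a (t ℕ.+ J)) * ι (binomℚ (ℕtoℚ (t ℕ.+ J)) J)) * (u ^ t * (v ^ J * c ^ J))
        ≈⟨ *-cong (trans (sym (*-homo _ _)) (trans (⟦⟧-cong (binomℚ-trinomial-revision a t J)) (*-homo _ _))) refl ⟩
      (ι (binomℚ a J) * ι (binomℚ (a Q.- ℕtoℚ J) t)) * (u ^ t * (v ^ J * c ^ J))
        ≈⟨ solve 5 (λ A B p q r → (A :* B) :* (p :* (q :* r)) := (A :* (q :* r)) :* (B :* p)) refl
                 (ι (binomℚ a J)) (ι (binomℚ (a Q.- ℕtoℚ J) t)) (u ^ t) (v ^ J) (c ^ J) ⟩
      Z J t ∎
    Z-vanishes : ∀ J t → J < suc M → suc (M ∸ J) ≤ t → Z J t ≈ 0#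
    Z-vanishes J t (s≤s J≤M) M-J<t = begin
      Z J t
        ≈⟨ solve 5 (λ A B p q r → (A :* (q :* r)) :* (B :* p) := (A :* (r :* B)) :* (p :* q)) refl
                 (ι (binomℚ a J)) (ι (binomℚ (a Q.- ℕtoℚ J) t)) (u ^ t) (v ^ J) (c ^ J) ⟩
      _ * (u ^ t * v ^ J)  ≈⟨ *-cong refl (nilpotent t J (P.subst (_< t ℕ.+ J) (ℕₚ.m∸n+n≡m J≤M) (ℕₚ.+-monoˡ-≤ J M-J<t))) ⟩
      _ * 0#               ≈⟨ zeroʳ _ ⟩
      0#                   ∎

module MultivariateSeries where
  open Q using (0ℚ; 1ℚ; _+_; _*_)
  open P using (refl; sym; trans; cong; cong₂)
  open import Algebra.Structures using (IsCommutativeMonoid)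
  open import Algebra.Structures.Biased using (isCommutativeSemiringˡ)
  open import Data.Product using (_,_)
  open import Relation.Binary.Structures using (IsEquivalence)

  open ℚSums using (Σ<)

  Ser : ℕ → Set
  Ser N = Vec ℕ N → ℚ

  slice : ∀ {N} → ℕ → Ser (suc N) → Ser N
  slice i f e = f (i ∷ e)

  conv : ∀ {N} → Ser N → Ser N → Ser N
  conv {zero} f g [] = f [] * g []
  conv {suc N} f g (j ∷ e) = Σ< (suc j) (λ i → conv (slice i f) (slice (j ∸ i) g) e)

  δ : ∀ {N} → Ser N
  δ {zero} [] = 1ℚ
  δ {suc N} (zero ∷ e) = δ e
  δ {suc N} (suc _ ∷ e) = 0ℚ

  𝟘 : ∀ {N} → Ser N
  𝟘 _ = 0ℚ

  _⊕_ : ∀ {N} → Ser N → Ser N → Ser N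
  (f ⊕ g) e = f e + g e

  infix 4 _≗_ _≈[_]_

  _≗_ : ∀ {N} → Ser N → Ser N → Set
  f ≗ g = ∀ e → f e ≡ g e

  conv-cong-≤ : ∀ {N} (f f′ g g′ : Ser N) e →
                (∀ e′ → vsum e′ ≤ vsum e → f e′ ≡ f′ e′) → (∀ e′ → vsum e′ ≤ vsum e → g e′ ≡ g′ e′) →
                conv f g e ≡ conv f′ g′ e
  conv-cong-≤ {zero} f f′ g g′ [] f≈f′ g≈g′ = cong₂ _*_ (f≈f′ [] ℕₚ.≤-refl) (g≈g′ [] ℕₚ.≤-refl)
  conv-cong-≤ {suc N} f f′ g g′ (j ∷ e) f≈f′ g≈g′ = ℚSums.Σ<-cong (suc j) (λ i i<1+j →
    conv-cong-≤ (slice i f) (slice i f′) (slice (j ∸ i) g) (slice (j ∸ i) g′) e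
      (λ e′ le → f≈f′ (i ∷ e′) (ℕₚ.+-mono-≤ (ℕₚ.≤-pred i<1+j) le))
      (λ e′ le → g≈g′ ((j ∸ i) ∷ e′) (ℕₚ.+-mono-≤ (ℕₚ.m∸n≤m j i) le)))

  conv-cong : ∀ {N} {f f′ g g′ : Ser N} → f ≗ f′ → g ≗ g′ → conv f g ≗ conv f′ g′
  conv-cong {f = f} {f′} {g} {g′} f≗f′ g≗g′ e = conv-cong-≤ f f′ g g′ e (λ e′ _ → f≗f′ e′) (λ e′ _ → g≗g′ e′)

  conv-zeroˡ : ∀ {N} (f g : Ser N) → f ≗ 𝟘 → conv f g ≗ 𝟘
  conv-zeroˡ {zero} f g f≗0 [] = trans (cong (_* g []) (f≗0 [])) (ℚₚ.*-zeroˡ (g []))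
  conv-zeroˡ {suc N} f g f≗0 (j ∷ e) =
    ℚSums.Σ<-zero (suc j) (λ i _ → conv-zeroˡ (slice i f) (slice (j ∸ i) g) (λ e′ → f≗0 (i ∷ e′)) e)

  conv-+ˡ : ∀ {N} (f f′ g : Ser N) → conv (f ⊕ f′) g ≗ (conv f g ⊕ conv f′ g)
  conv-+ˡ {zero} f f′ g [] = ℚₚ.*-distribʳ-+ (g []) (f []) (f′ [])
  conv-+ˡ {suc N} f f′ g (j ∷ e) =
    trans (ℚSums.Σ<-cong′ (suc j) (λ i → conv-+ˡ (slice i f) (slice i f′) (slice (j ∸ i) g) e)) (ℚSums.Σ<-+ (suc j) _ _)

  conv-*ˡ : ∀ {N} c (f g : Ser N) → conv (λ x → c * f x) g ≗ (λ x → c * conv f g x)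
  conv-*ˡ {zero} c f g [] = ℚₚ.*-assoc c (f []) (g [])
  conv-*ˡ {suc N} c f g (j ∷ e) =
    trans (ℚSums.Σ<-cong′ (suc j) (λ i → conv-*ˡ c (slice i f) (slice (j ∸ i) g) e)) (sym (ℚSums.Σ<-*ˡ (suc j) c _))

  conv-Σ<ˡ : ∀ {N} n (F : ℕ → Ser N) (g : Ser N) → conv (λ x → Σ< n (λ t → F t x)) g ≗ (λ x → Σ< n (λ t → conv (F t) g x))
  conv-Σ<ˡ zero F g = conv-zeroˡ _ g (λ _ → refl)
  conv-Σ<ˡ (suc n) F g e = trans (conv-+ˡ (λ x → Σ< n (λ t → F t x)) (F n) g e) (cong (_+ conv (F n) g e) (conv-Σ<ˡ n F g e))

  conv-comm : ∀ {N} (f g : Ser N) → conv f g ≗ conv g f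
  conv-comm {zero} f g [] = ℚₚ.*-comm (f []) (g [])
  conv-comm {suc N} f g (j ∷ e) = begin
    Σ< (suc j) (λ i → conv (slice i f) (slice (j ∸ i) g) e)
      ≡⟨ ℚSums.Σ<-cong′ (suc j) (λ i → conv-comm (slice i f) (slice (j ∸ i) g) e) ⟩
    Σ< (suc j) (λ i → conv (slice (j ∸ i) g) (slice i f) e)
      ≡⟨ ℚSums.Σ<-reverse (suc j) _ ⟩
    Σ< (suc j) (λ i → conv (slice (j ∸ (j ∸ i)) g) (slice (j ∸ i) f) e)
      ≡⟨ ℚSums.Σ<-cong (suc j) (λ i i<1+j → cong (λ k → conv (slice k g) (slice (j ∸ i) f) e) (ℕₚ.m∸[m∸n]≡n (ℕₚ.≤-pred i<1+j))) ⟩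
    Σ< (suc j) (λ i → conv (slice i g) (slice (j ∸ i) f) e) ∎
    where open P.≡-Reasoning

  conv-Σ<ʳ : ∀ {N} n (f : Ser N) (G : ℕ → Ser N) → conv f (λ x → Σ< n (λ t → G t x)) ≗ (λ x → Σ< n (λ t → conv f (G t) x))
  conv-Σ<ʳ n f G e = trans (conv-comm f _ e) (trans (conv-Σ<ˡ n G f e) (ℚSums.Σ<-cong′ n (λ t → conv-comm (G t) f e)))

  conv-δˡ : ∀ {N} (g : Ser N) → conv δ g ≗ g
  conv-δˡ {zero} g [] = ℚₚ.*-identityˡ (g [])
  conv-δˡ {suc N} g (j ∷ e) = begin
    Σ< (suc j) (λ i → conv (slice i δ) (slice (j ∸ i) g) e)
      ≡⟨ ℚSums.Σ<-head j _ ⟩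
    conv δ (slice j g) e + Σ< j (λ i → conv (slice (suc i) δ) (slice (j ∸ suc i) g) e)
      ≡⟨ cong₂ _+_ (conv-δˡ (slice j g) e) (ℚSums.Σ<-zero j (λ i _ → conv-zeroˡ (slice (suc i) δ) _ (λ _ → refl) e)) ⟩
    g (j ∷ e) + 0ℚ
      ≡⟨ ℚₚ.+-identityʳ _ ⟩
    g (j ∷ e) ∎
    where open P.≡-Reasoning

  conv-assoc : ∀ {N} (f g h : Ser N) → conv (conv f g) h ≗ conv f (conv g h)
  conv-assoc {zero} f g h [] = ℚₚ.*-assoc (f []) (g []) (h [])
  conv-assoc {suc N} f g h (j ∷ e) = begin
    Σ< (suc j) (λ i → conv (slice i (conv f g)) (slice (j ∸ i) h) e)
      ≡⟨ ℚSums.Σ<-cong′ (suc j) (λ i → conv-Σ<ˡ (suc i) (λ i′ → conv (slice i′ f) (slice (i ∸ i′) g)) (slice (j ∸ i) h) e) ⟩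
    Σ< (suc j) (λ i → Σ< (suc i) (λ i′ → conv (conv (slice i′ f) (slice (i ∸ i′) g)) (slice (j ∸ i) h) e))
      ≡⟨ ℚSums.Σ<-cong′ (suc j) (λ i → ℚSums.Σ<-cong′ (suc i) (λ i′ → conv-assoc (slice i′ f) (slice (i ∸ i′) g) (slice (j ∸ i) h) e)) ⟩
    Σ< (suc j) (λ i → Σ< (suc i) (T i))
      ≡⟨ ℚSums.Σ<-triangle j T ⟩
    Σ< (suc j) (λ i′ → Σ< (suc (j ∸ i′)) (λ s → T (s ℕ.+ i′) i′))
      ≡⟨ ℚSums.Σ<-cong′ (suc j) (λ i′ → ℚSums.Σ<-cong′ (suc (j ∸ i′)) (λ s → reindex s i′)) ⟩
    Σ< (suc j) (λ i′ → Σ< (suc (j ∸ i′)) (λ s → conv (slice i′ f) (conv (slice s g) (slice (j ∸ i′ ∸ s) h)) e))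
      ≡⟨ ℚSums.Σ<-cong′ (suc j) (λ i′ → sym (conv-Σ<ʳ (suc (j ∸ i′)) (slice i′ f) (λ s → conv (slice s g) (slice (j ∸ i′ ∸ s) h)) e)) ⟩
    Σ< (suc j) (λ i′ → conv (slice i′ f) (slice (j ∸ i′) (conv g h)) e) ∎
    where
    open P.≡-Reasoning
    T : ℕ → ℕ → ℚ
    T i i′ = conv (slice i′ f) (conv (slice (i ∸ i′) g) (slice (j ∸ i) h)) e
    reindex : ∀ s i′ → T (s ℕ.+ i′) i′ ≡ conv (slice i′ f) (conv (slice s g) (slice (j ∸ i′ ∸ s) h)) e
    reindex s i′ = cong₂ (λ a b → conv (slice i′ f) (conv (slice a g) (slice b h)) e)
      (ℕₚ.m+n∸n≡m s i′) (trans (cong (j ∸_) (ℕₚ.+-comm s i′)) (sym (ℕₚ.∸-+-assoc j i′ s)))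

  OrderAtLeast : ∀ {N} → ℕ → Ser N → Set
  OrderAtLeast m f = ∀ e → vsum e < m → f e ≡ 0ℚ

  private
    <∸⇒+< : ∀ i m s → s < m ∸ i → i ℕ.+ s < m
    <∸⇒+< zero m s s<m = s<m
    <∸⇒+< (suc i) (suc m) s s<m∸i = s≤s (<∸⇒+< i m s s<m∸i)

    split-< : ∀ i k s m n → i ℕ.+ k ℕ.+ s < m ℕ.+ n → s < (m ∸ i) ℕ.+ (n ∸ k)
    split-< i k s m n lt = ℕₚ.+-cancelˡ-< (i ℕ.+ k) s _ (begin-strict
      i ℕ.+ k ℕ.+ s                         <⟨ lt ⟩
      m ℕ.+ n                               ≤⟨ ℕₚ.+-mono-≤ (ℕₚ.m≤n+m∸n m i) (ℕₚ.m≤n+m∸n n k) ⟩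
      (i ℕ.+ (m ∸ i)) ℕ.+ (k ℕ.+ (n ∸ k))   ≡⟨ interchange i (m ∸ i) k (n ∸ k) ⟩
      (i ℕ.+ k) ℕ.+ ((m ∸ i) ℕ.+ (n ∸ k))   ∎)
      where
      open ℕₚ.≤-Reasoning
      open import Algebra.Properties.CommutativeSemigroup ℕₚ.+-commutativeSemigroup using (interchange)

  conv-order : ∀ {N} m n (f g : Ser N) → OrderAtLeast m f → OrderAtLeast n g → OrderAtLeast (m ℕ.+ n) (conv f g)
  conv-order {zero} zero n f g _ g≥n [] lt = trans (cong (f [] *_) (g≥n [] lt)) (ℚₚ.*-zeroʳ (f []))
  conv-order {zero} (suc m) n f g f≥m _ [] _ = trans (cong (_* g []) (f≥m [] (s≤s z≤n))) (ℚₚ.*-zeroˡ (g []))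
  conv-order {suc N} m n f g f≥m g≥n (j ∷ e) lt = ℚSums.Σ<-zero (suc j) (λ i i<1+j →
    conv-order (m ∸ i) (n ∸ (j ∸ i)) (slice i f) (slice (j ∸ i) g)
      (λ e′ lt′ → f≥m (i ∷ e′) (<∸⇒+< i m _ lt′))
      (λ e′ lt′ → g≥n ((j ∸ i) ∷ e′) (<∸⇒+< (j ∸ i) n _ lt′))
      e (split-< i (j ∸ i) (vsum e) m n (P.subst (λ k → k ℕ.+ vsum e < m ℕ.+ n) (sym (ℕₚ.m+[n∸m]≡n (ℕₚ.≤-pred i<1+j))) lt)))

  _≈[_]_ : ∀ {N} → Ser N → ℕ → Ser N → Set
  f ≈[ D ] g = ∀ e → vsum e ≤ D → f e ≡ g e

  -- In this quotient every series of order > D is 0, so the finite sums binomialSum D a u behave like (1 + u)ᵃ.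
  Truncated : ℕ → ℕ → CommutativeSemiring 0ℓ 0ℓ
  Truncated N D = record
    { Carrier = Ser N ; _≈_ = _≈[ D ]_ ; _+_ = _⊕_ ; _*_ = conv ; 0# = 𝟘 ; 1# = δ
    ; isCommutativeSemiring = isCommutativeSemiringˡ (record
        { +-isCommutativeMonoid = +-isCommutativeMonoid
        ; *-isCommutativeMonoid = *-isCommutativeMonoid
        ; distribʳ = λ x y z → pointwise (conv-+ˡ y z x)
        ; zeroˡ = λ x → pointwise (conv-zeroˡ 𝟘 x (λ _ → refl)) }) }
    where
    pointwise : ∀ {f g : Ser N} → f ≗ g → f ≈[ D ] g
    pointwise f≗g e _ = f≗g e
    isEquivalence : IsEquivalence {A = Ser N} _≈[ D ]_
    isEquivalence = record { refl = λ e _ → refl ; sym = λ f≈g e le → sym (f≈g e le) ; trans = λ f≈g g≈h e le → trans (f≈g e le) (g≈h e le) }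
    +-isCommutativeMonoid : IsCommutativeMonoid _≈[ D ]_ _⊕_ 𝟘
    +-isCommutativeMonoid = record
      { isMonoid = record
        { isSemigroup = record
          { isMagma = record { isEquivalence = isEquivalence ; ∙-cong = λ f≈f′ g≈g′ e le → cong₂ _+_ (f≈f′ e le) (g≈g′ e le) }
          ; assoc = λ f g h → pointwise (λ e → ℚₚ.+-assoc (f e) (g e) (h e)) }
        ; identity = (λ f → pointwise (λ e → ℚₚ.+-identityˡ (f e))) , (λ f → pointwise (λ e → ℚₚ.+-identityʳ (f e))) }
      ; comm = λ f g → pointwise (λ e → ℚₚ.+-comm (f e) (g e)) }
    *-isCommutativeMonoid : IsCommutativeMonoid _≈[ D ]_ conv δ
    *-isCommutativeMonoid = record
      { isMonoid = record
        { isSemigroup = record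
          { isMagma = record
            { isEquivalence = isEquivalence
            ; ∙-cong = λ {f} {f′} {g} {g′} f≈f′ g≈g′ e le →
                conv-cong-≤ f f′ g g′ e (λ e′ le′ → f≈f′ e′ (ℕₚ.≤-trans le′ le))
                                        (λ e′ le′ → g≈g′ e′ (ℕₚ.≤-trans le′ le)) }
          ; assoc = λ f g h → pointwise (conv-assoc f g h) }
        ; identity = (λ f → pointwise (conv-δˡ f)) , (λ f → pointwise (λ e → trans (conv-comm f δ e) (conv-δˡ f e))) }
      ; comm = λ f g → pointwise (conv-comm f g) }

module IndicatorSums where
  open ℚSums using (Σ<; ΣL)
  open Q using (0ℚ; 1ℚ; _+_; _*_)
  open P using (refl; sym; trans; cong; cong₂)
  open import Data.Empty using (⊥-elim)
  open import Data.Sum using (inj₁; inj₂)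
  open import Relation.Nullary using (¬_)

  ≡ᵇ-refl : ∀ n → (n ≡ᵇ n) ≡ true
  ≡ᵇ-refl zero = refl
  ≡ᵇ-refl (suc n) = ≡ᵇ-refl n

  ≢⇒≡ᵇ-false : ∀ m n → ¬ m ≡ n → (m ≡ᵇ n) ≡ false
  ≢⇒≡ᵇ-false zero zero m≢n = ⊥-elim (m≢n refl)
  ≢⇒≡ᵇ-false zero (suc n) _ = refl
  ≢⇒≡ᵇ-false (suc m) zero _ = refl
  ≢⇒≡ᵇ-false (suc m) (suc n) m≢n = ≢⇒≡ᵇ-false m n (λ m≡n → m≢n (cong suc m≡n))

  +-≡ᵇ-+ : ∀ k m n → ((k ℕ.+ m) ≡ᵇ (k ℕ.+ n)) ≡ (m ≡ᵇ n)
  +-≡ᵇ-+ zero m n = refl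
  +-≡ᵇ-+ (suc k) m n = +-≡ᵇ-+ k m n

  if-*ʳ : ∀ (b : Bool) (x y : ℚ) → (if b then x else 0ℚ) * y ≡ (if b then x * y else 0ℚ)
  if-*ʳ true x y = refl
  if-*ʳ false x y = ℚₚ.*-zeroˡ y

  if-*ˡ : ∀ (b : Bool) (x y : ℚ) → x * (if b then y else 0ℚ) ≡ (if b then x * y else 0ℚ)
  if-*ˡ true x y = refl
  if-*ˡ false x y = ℚₚ.*-zeroʳ x

  Σ<-select-out : ∀ n k (F : ℕ → ℚ) → n ≤ k → Σ< n (λ i → if i ≡ᵇ k then F i else 0ℚ) ≡ 0ℚ
  Σ<-select-out n k F n≤k = ℚSums.Σ<-zero n (λ i i<n →
    cong (λ b → if b then F i else 0ℚ) (≢⇒≡ᵇ-false i k (λ i≡k → ℕₚ.<-irrefl i≡k (ℕₚ.<-≤-trans i<n n≤k))))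

  Σ<-select : ∀ n k (F : ℕ → ℚ) → k < n → Σ< n (λ i → if i ≡ᵇ k then F i else 0ℚ) ≡ F k
  Σ<-select (suc n) k F (s≤s k≤n) with ℕₚ.m≤n⇒m<n∨m≡n k≤n
  ... | inj₁ k<n = trans (cong₂ _+_ (Σ<-select n k F k<n)
                                    (cong (λ b → if b then F n else 0ℚ) (≢⇒≡ᵇ-false n k (λ n≡k → ℕₚ.<-irrefl (sym n≡k) k<n))))
                         (ℚₚ.+-identityʳ (F k))
  ... | inj₂ refl = trans (cong₂ _+_ (Σ<-select-out k k F ℕₚ.≤-refl) (cong (λ b → if b then F k else 0ℚ) (≡ᵇ-refl k)))
                          (ℚₚ.+-identityˡ (F k))

  ≡ᵇ-sym : ∀ m n → (m ≡ᵇ n) ≡ (n ≡ᵇ m)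
  ≡ᵇ-sym zero zero = refl
  ≡ᵇ-sym zero (suc n) = refl
  ≡ᵇ-sym (suc m) zero = refl
  ≡ᵇ-sym (suc m) (suc n) = ≡ᵇ-sym m n

  ΣL-allSubsets-suc : ∀ {N} (F : Subset (suc N) → ℚ) →
                      ΣL (allSubsets (suc N)) F ≡ ΣL (allSubsets N) (λ s → F (true ∷ s)) + ΣL (allSubsets N) (λ s → F (false ∷ s))
  ΣL-allSubsets-suc {N} F = trans (ℚSums.ΣL-++ (map (true ∷_) (allSubsets N)) _ F)
    (cong₂ _+_ (ℚSums.ΣL-map (allSubsets N) (true ∷_) F) (ℚSums.ΣL-map (allSubsets N) (false ∷_) F))

  ΣL-if : ∀ {A : Set} (xs : List A) (b : Bool) (X : A → ℚ) → ΣL xs (λ s → if b then X s else 0ℚ) ≡ (if b then ΣL xs X else 0ℚ)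
  ΣL-if xs true X = refl
  ΣL-if xs false X = ℚSums.ΣL-zero xs

  𝟙 : Bool → ℚ
  𝟙 b = if b then 1ℚ else 0ℚ

  𝟙-∧ : ∀ a b → 𝟙 (a ∧ b) ≡ 𝟙 a * 𝟙 b
  𝟙-∧ true b = sym (ℚₚ.*-identityˡ (𝟙 b))
  𝟙-∧ false b = sym (ℚₚ.*-zeroˡ (𝟙 b))

  if≡𝟙* : ∀ b x → (if b then x else 0ℚ) ≡ 𝟙 b * x
  if≡𝟙* true x = sym (ℚₚ.*-identityˡ x)
  if≡𝟙* false x = sym (ℚₚ.*-zeroˡ x)

  ΣL-𝟙-∧ : ∀ {A : Set} (xs : List A) b (p : A → Bool) → ΣL xs (λ x → 𝟙 (b ∧ p x)) ≡ (if b then ΣL xs (λ x → 𝟙 (p x)) else 0ℚ)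
  ΣL-𝟙-∧ xs true p = refl
  ΣL-𝟙-∧ xs false p = ℚSums.ΣL-zero xs

  ℕtoℚ-countB : ∀ {A : Set} (p : A → Bool) xs → ℕtoℚ (countB p xs) ≡ ΣL xs (λ x → 𝟙 (p x))
  ℕtoℚ-countB p [] = refl
  ℕtoℚ-countB p (x ∷ xs) with p x
  ... | true = trans (NatCast.ℕtoℚ-suc (countB p xs)) (cong (1ℚ +_) (ℕtoℚ-countB p xs))
  ... | false = trans (ℕtoℚ-countB p xs) (sym (ℚₚ.+-identityˡ _))

module SeriesConstructions where
  open MultivariateSeries
  open IndicatorSums
  open ℚSums using (Σ<)
  open Q using (0ℚ; _+_; _*_)
  open P using (refl; sym; trans; cong)
  open import Relation.Nullary using (Dec; yes; no)

  scalar : ∀ {N} → ℚ → Ser N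
  scalar c e = c * δ e

  conv-scalarˡ : ∀ {N} c (f : Ser N) → conv (scalar c) f ≗ (λ e → c * f e)
  conv-scalarˡ c f e = trans (conv-*ˡ c δ f e) (cong (c *_) (conv-δˡ f e))

  scalar-* : ∀ {N} p q → scalar {N} (p * q) ≗ conv (scalar p) (scalar q)
  scalar-* p q e = trans (ℚₚ.*-assoc p q (δ e)) (sym (conv-scalarˡ p (scalar q) e))

  module InTruncated (N D : ℕ) where
    module S = SemiringSums (Truncated N D)

    scalar-isSemiringHomomorphism : IsSemiringHomomorphism Q.+-*-rawSemiring (CommutativeSemiring.rawSemiring (Truncated N D)) scalar
    scalar-isSemiringHomomorphism = record
      { isNearSemiringHomomorphism = record
        { +-isMonoidHomomorphism = record
          { isMagmaHomomorphism = record
            { isRelHomomorphism = record { cong = λ p≡q e _ → cong (λ c → scalar c e) p≡q }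
            ; homo = λ p q e _ → ℚₚ.*-distribʳ-+ (δ e) p q }
          ; ε-homo = λ e _ → ℚₚ.*-zeroˡ (δ e) }
        ; *-homo = λ p q e _ → scalar-* p q e }
      ; 1#-homo = λ e _ → ℚₚ.*-identityˡ (δ e) }

    module B = BinomialSeries (Truncated N D) scalar scalar-isSemiringHomomorphism
    open S using (_^_) public
    open B using (binomialSum) public

    Σ<-apply : ∀ n (F : ℕ → Ser N) e → S.Σ< n F e ≡ Σ< n (λ t → F t e)
    Σ<-apply zero F e = refl
    Σ<-apply (suc n) F e = cong (_+ F n e) (Σ<-apply n F e)

    ΣL-apply : ∀ {A : Set} (xs : List A) (F : A → Ser N) e → S.ΣL xs F e ≡ ℚSums.ΣL xs (λ x → F x e)
    ΣL-apply [] F e = refl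
    ΣL-apply (x ∷ xs) F e = cong (F x e +_) (ΣL-apply xs F e)

    binomialSum-apply : ∀ M a (u : Ser N) e → binomialSum M a u e ≡ Σ< (suc M) (λ x → binomℚ a x * (u ^ x) e)
    binomialSum-apply M a u e = trans (Σ<-apply (suc M) _ e) (ℚSums.Σ<-cong′ (suc M) (λ x → conv-scalarˡ (binomℚ a x) (u ^ x) e))

    binomialSum-cong : ∀ M a {u u′ : Ser N} → u ≈[ D ] u′ → binomialSum M a u ≈[ D ] binomialSum M a u′
    binomialSum-cong M a u≈u′ = S.Σ<-cong′ (suc M) (λ x → CommutativeSemiring.*-cong (Truncated N D)
      {scalar (binomℚ a x)} {scalar (binomℚ a x)} (λ e _ → refl) (^-congˡ x u≈u′))
      where open import Algebra.Properties.Semiring.Exp (CommutativeSemiring.semiring (Truncated N D)) using (^-congˡ)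

    ^-order : ∀ m (f : Ser N) n → OrderAtLeast m f → OrderAtLeast (m ℕ.* n) (f ^ n)
    ^-order m f zero _ e lt rewrite ℕₚ.*-zeroʳ m with lt
    ... | ()
    ^-order m f (suc n) f≥m e lt =
      conv-order m (m ℕ.* n) f _ f≥m (^-order m f n f≥m) e (P.subst (vsum e <_) (ℕₚ.*-suc m n) lt)

  open InTruncated public using (binomialSum) renaming (_^_ to pow)

  lift : ∀ {N} → Ser N → Ser (suc N)
  lift f (zero ∷ e) = f e
  lift f (suc _ ∷ e) = 0ℚ

  lift-conv : ∀ {N} (f g : Ser N) → lift (conv f g) ≗ conv (lift f) (lift g)
  lift-conv f g (zero ∷ e) = sym (ℚₚ.+-identityˡ _)
  lift-conv f g (suc j ∷ e) = sym (ℚSums.Σ<-zero (suc (suc j)) term)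
    where
    term : ∀ i → i < suc (suc j) → conv (slice i (lift f)) (slice (suc j ∸ i) (lift g)) e ≡ 0ℚ
    term zero _ = trans (conv-comm f (slice (suc j) (lift g)) e) (conv-zeroˡ (slice (suc j) (lift g)) f (λ _ → refl) e)
    term (suc i) _ = conv-zeroˡ (slice (suc i) (lift f)) _ (λ _ → refl) e

  lift-δ : ∀ {N} → lift (δ {N}) ≗ δ
  lift-δ (zero ∷ e) = refl
  lift-δ (suc _ ∷ e) = refl

  lift-pow : ∀ N D (f : Ser N) n → lift (pow N D f n) ≗ pow (suc N) D (lift f) n
  lift-pow N D f zero = lift-δ
  lift-pow N D f (suc n) e = trans (lift-conv f _ e) (conv-cong (λ _ → refl) (lift-pow N D f n) e)

  lift-binomialSum : ∀ N D M a (f : Ser N) → lift (binomialSum N D M a f) ≗ binomialSum (suc N) D M a (lift f)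
  lift-binomialSum N D M a f (zero ∷ e) = begin
    binomialSum N D M a f e
      ≡⟨ InTruncated.binomialSum-apply N D M a f e ⟩
    Σ< (suc M) (λ x → binomℚ a x * pow N D f x e)
      ≡⟨ ℚSums.Σ<-cong′ (suc M) (λ x → cong (binomℚ a x *_) (lift-pow N D f x (zero ∷ e))) ⟩
    Σ< (suc M) (λ x → binomℚ a x * pow (suc N) D (lift f) x (zero ∷ e))
      ≡⟨ InTruncated.binomialSum-apply (suc N) D M a (lift f) (zero ∷ e) ⟨
    binomialSum (suc N) D M a (lift f) (zero ∷ e) ∎
    where open P.≡-Reasoning
  lift-binomialSum N D M a f (suc j ∷ e) = sym (trans (InTruncated.binomialSum-apply (suc N) D M a (lift f) (suc j ∷ e))
    (ℚSums.Σ<-zero (suc M) (λ x _ → trans (cong (binomℚ a x *_) (sym (lift-pow N D f x (suc j ∷ e)))) (ℚₚ.*-zeroʳ (binomℚ a x)))))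

  lift-≈ : ∀ {N} D {f g : Ser N} → f ≈[ D ] g → lift f ≈[ D ] lift g
  lift-≈ D f≈g (zero ∷ e) le = f≈g e le
  lift-≈ D f≈g (suc j ∷ e) le = refl

  lift-order : ∀ {N} m (f : Ser N) → OrderAtLeast m f → OrderAtLeast m (lift f)
  lift-order m f f≥m (zero ∷ e) lt = f≥m e lt
  lift-order m f f≥m (suc j ∷ e) lt = refl

  x₀^ : ∀ {N} → ℕ → Ser (suc N)
  x₀^ k (i ∷ e) = if i ≡ᵇ k then δ e else 0ℚ

  conv-x₀^ : ∀ {N} k c (g : Ser (suc N)) (G : ℚ) j e → (∀ m → g (m ∷ e) ≡ (if c ≡ᵇ m then G else 0ℚ)) →
             conv (x₀^ k) g (j ∷ e) ≡ (if (k ℕ.+ c) ≡ᵇ j then G else 0ℚ)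
  conv-x₀^ k c g G j e g-at-c = trans unfold-x₀^ (select (k ℕ.≤? j))
    where
    δ-if : ∀ b (h : Ser _) → conv (λ e′ → if b then δ e′ else 0ℚ) h e ≡ (if b then h e else 0ℚ)
    δ-if true h = conv-δˡ h e
    δ-if false h = conv-zeroˡ _ h (λ _ → refl) e
    unfold-x₀^ : conv (x₀^ k) g (j ∷ e) ≡ Σ< (suc j) (λ i → if i ≡ᵇ k then g ((j ∸ i) ∷ e) else 0ℚ)
    unfold-x₀^ = ℚSums.Σ<-cong′ (suc j) (λ i → δ-if (i ≡ᵇ k) (slice (j ∸ i) g))
    select : Dec (k ≤ j) → Σ< (suc j) (λ i → if i ≡ᵇ k then g ((j ∸ i) ∷ e) else 0ℚ) ≡ (if (k ℕ.+ c) ≡ᵇ j then G else 0ℚ)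
    select (yes k≤j) = trans (Σ<-select (suc j) k (λ i → g ((j ∸ i) ∷ e)) (s≤s k≤j)) (trans (g-at-c (j ∸ k))
      (cong (λ b → if b then G else 0ℚ) (trans (sym (+-≡ᵇ-+ k c (j ∸ k))) (cong ((k ℕ.+ c) ≡ᵇ_) (ℕₚ.m+[n∸m]≡n k≤j)))))
    select (no k≰j) = trans (Σ<-select-out (suc j) k (λ i → g ((j ∸ i) ∷ e)) (ℕₚ.≰⇒> k≰j))
      (cong (λ b → if b then G else 0ℚ) (sym (≢⇒≡ᵇ-false (k ℕ.+ c) j (λ k+c≡j → k≰j (P.subst (k ≤_) k+c≡j (ℕₚ.m≤m+n k c))))))

  pow-x₀^ : ∀ N D k x j e → pow (suc N) D (x₀^ k) x (j ∷ e) ≡ (if (k ℕ.* x) ≡ᵇ j then δ e else 0ℚ)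
  pow-x₀^ N D k zero zero e rewrite ℕₚ.*-zeroʳ k = refl
  pow-x₀^ N D k zero (suc j) e rewrite ℕₚ.*-zeroʳ k = refl
  pow-x₀^ N D k (suc x) j e = trans (conv-x₀^ k (k ℕ.* x) (pow (suc N) D (x₀^ k) x) (δ e) j e (λ m → pow-x₀^ N D k x m e))
    (cong (λ z → if z ≡ᵇ j then δ e else 0ℚ) (sym (ℕₚ.*-suc k x)))

  x₀^-order : ∀ {N} k → OrderAtLeast {suc N} k (x₀^ k)
  x₀^-order k (i ∷ e) lt = cong (λ b → if b then δ e else 0ℚ)
    (≢⇒≡ᵇ-false i k (λ i≡k → ℕₚ.<-irrefl i≡k (ℕₚ.≤-<-trans (ℕₚ.m≤m+n i (vsum e)) lt)))

  inX₀ : ∀ {N} → (ℕ → ℚ) → Ser (suc N)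
  inX₀ β (j ∷ e) = β j * δ e

  binomialSum-x₀^ : ∀ N D k a → binomialSum (suc N) D D a (x₀^ (suc k)) ≈[ D ] inX₀ (binSeries (suc k) a)
  binomialSum-x₀^ N D k a (j ∷ e) le = begin
    binomialSum (suc N) D D a (x₀^ (suc k)) (j ∷ e)
      ≡⟨ InTruncated.binomialSum-apply (suc N) D D a _ (j ∷ e) ⟩
    Σ< (suc D) (λ x → binomℚ a x * pow (suc N) D (x₀^ (suc k)) x (j ∷ e))
      ≡⟨ ℚSums.Σ<-cong′ (suc D) (λ x → trans (cong (binomℚ a x *_) (pow-x₀^ N D (suc k) x j e))
                                          (trans (if-*ˡ (hit x) (binomℚ a x) (δ e)) (sym (if-*ʳ (hit x) (binomℚ a x) (δ e))))) ⟩
    Σ< (suc D) (λ x → (if hit x then binomℚ a x else 0ℚ) * δ e)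
      ≡⟨ ℚSums.Σ<-*ʳ (suc D) (δ e) _ ⟨
    Σ< (suc D) (λ x → if hit x then binomℚ a x else 0ℚ) * δ e
      ≡⟨ cong (_* δ e) (ℚSums.Σ<-vanishing-tail (suc D) _ (s≤s (ℕₚ.≤-trans (ℕₚ.m≤m+n j (vsum e)) le)) miss) ⟩
    Σ< (suc j) (λ x → if hit x then binomℚ a x else 0ℚ) * δ e
      ≡⟨ cong (_* δ e) (ℚSums.ΣL-applyUpTo (λ x → if hit x then binomℚ a x else 0ℚ) id (suc j)) ⟨
    binSeries (suc k) a j * δ e ∎
    where
    open P.≡-Reasoning
    hit : ℕ → Bool
    hit x = (suc k ℕ.* x) ≡ᵇ j
    miss : ∀ x → suc j ≤ x → x < suc D → (if hit x then binomℚ a x else 0ℚ) ≡ 0ℚ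
    miss x j<x _ = cong (λ b → if b then binomℚ a x else 0ℚ)
      (≢⇒≡ᵇ-false (suc k ℕ.* x) j (λ eq → ℕₚ.<-irrefl (sym eq) (ℕₚ.<-≤-trans j<x (ℕₚ.m≤m+n x (k ℕ.* x)))))

module ProdBinTruncation where
  open IndicatorSums using (≢⇒≡ᵇ-false)
  open ℚSums using (Σ<)
  open Q using (0ℚ; 1ℚ; _+_; _*_)
  open P using (refl; sym; trans; cong; cong₂)
  open P.≡-Reasoning

  binSeries-zero : ∀ k c → binSeries k c 0 ≡ 1ℚ
  binSeries-zero k c rewrite ℕₚ.*-zeroʳ k = refl

  binSeries-below : ∀ k c r → 0 < r → r < k → binSeries k c r ≡ 0ℚ
  binSeries-below k c r 0<r r<k = trans (ℚSums.ΣL-applyUpTo _ id (suc r)) (ℚSums.Σ<-zero (suc r) term)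
    where
    term : ∀ i → i < suc r → (if k ℕ.* i ≡ᵇ r then binomℚ c i else 0ℚ) ≡ 0ℚ
    term zero _ rewrite ℕₚ.*-zeroʳ k | ≢⇒≡ᵇ-false 0 r (λ 0≡r → ℕₚ.<-irrefl 0≡r 0<r) = refl
    term (suc i) _ rewrite ≢⇒≡ᵇ-false (k ℕ.* suc i) r (λ eq → ℕₚ.<-irrefl (sym eq) (ℕₚ.<-≤-trans r<k (ℕₚ.m≤m*n k (suc i)))) = refl

  ⊛-binSeries : ∀ (f : ℕ → ℚ) k c m → m < k → (f ⊛ binSeries k c) m ≡ f m
  ⊛-binSeries f k c m m<k = begin
    (f ⊛ binSeries k c) m
      ≡⟨ ℚSums.ΣL-applyUpTo (λ j → f j * binSeries k c (m ∸ j)) id (suc m) ⟩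
    Σ< m (λ j → f j * binSeries k c (m ∸ j)) + f m * binSeries k c (m ∸ m)
      ≡⟨ cong₂ _+_ (ℚSums.Σ<-zero m earlier) last ⟩
    0ℚ + f m
      ≡⟨ ℚₚ.+-identityˡ (f m) ⟩
    f m ∎
    where
    earlier : ∀ j → j < m → f j * binSeries k c (m ∸ j) ≡ 0ℚ
    earlier j j<m = trans (cong (f j *_) (binSeries-below k c (m ∸ j) (ℕₚ.m<n⇒0<n∸m j<m) (ℕₚ.≤-<-trans (ℕₚ.m∸n≤m m j) m<k)))
                          (ℚₚ.*-zeroʳ (f j))
    last : f m * binSeries k c (m ∸ m) ≡ f m
    last = trans (cong (λ r → f m * binSeries k c r) (ℕₚ.n∸n≡0 m)) (trans (cong (f m *_) (binSeries-zero k c)) (ℚₚ.*-identityʳ (f m)))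

  prodBin-stable : ∀ (a : ℕ → ℚ) m k → prodBin (k ℕ.+ m) a m ≡ prodBinCoeff a m
  prodBin-stable a m zero = refl
  prodBin-stable a m (suc k) =
    trans (⊛-binSeries (prodBin (k ℕ.+ m) a) (suc (k ℕ.+ m)) (a (suc (k ℕ.+ m))) m (s≤s (ℕₚ.m≤n+m m k))) (prodBin-stable a m k)

  prodBin-stable-≤ : ∀ (a : ℕ → ℚ) {m D} → m ≤ D → prodBin D a m ≡ prodBinCoeff a m
  prodBin-stable-≤ a {m} {D} m≤D = trans (cong (λ d → prodBin d a m) (sym (ℕₚ.m∸n+n≡m m≤D))) (prodBin-stable a m (D ∸ m))

module SeparableSeries where
  open MultivariateSeries
  open SeriesConstructions
  open ProdBinTruncation using (prodBin-stable-≤)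
  open ℚSums using (Σ<)
  open Q using (0ℚ; 1ℚ; _+_; _*_)
  open P using (refl; sym; trans; cong; cong₂)

  separable : ∀ {N} → (ℕ → ℚ) → Ser N
  separable β [] = 1ℚ
  separable β (j ∷ e) = β j * separable β e

  conv-lift-inX₀ : ∀ {N} (β : ℕ → ℚ) → conv (lift (separable {N} β)) (inX₀ β) ≗ separable β
  conv-lift-inX₀ β (j ∷ e) = begin
    Σ< (suc j) (λ i → conv (slice i (lift (separable β))) (slice (j ∸ i) (inX₀ β)) e)
      ≡⟨ ℚSums.Σ<-head j _ ⟩
    conv (separable β) (scalar (β j)) e + Σ< j (λ i → conv (slice (suc i) (lift (separable β))) (slice (j ∸ suc i) (inX₀ β)) e)
      ≡⟨ cong₂ _+_ (trans (conv-comm (separable β) (scalar (β j)) e) (conv-scalarˡ (β j) (separable β) e))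
                   (ℚSums.Σ<-zero j (λ i _ → conv-zeroˡ _ _ (λ _ → refl) e)) ⟩
    β j * separable β e + 0ℚ
      ≡⟨ ℚₚ.+-identityʳ _ ⟩
    β j * separable β e ∎
    where open P.≡-Reasoning

  conv-*-* : ∀ {N} c d (f g : Ser N) e → conv (λ x → c * f x) (λ x → d * g x) e ≡ c * (d * conv f g e)
  conv-*-* c d f g e = trans (conv-*ˡ c f _ e) (cong (c *_) (trans (conv-comm f _ e)
                         (trans (conv-*ˡ d g f e) (cong (d *_) (conv-comm g f e)))))

  separable-⊛ : ∀ {N} (f g : ℕ → ℚ) → conv (separable {N} f) (separable g) ≗ separable (f ⊛ g)
  separable-⊛ f g [] = ℚₚ.*-identityˡ 1ℚ
  separable-⊛ f g (j ∷ e) = begin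
    Σ< (suc j) (λ i → conv (slice i (separable f)) (slice (j ∸ i) (separable g)) e)
      ≡⟨ ℚSums.Σ<-cong′ (suc j) (λ i → trans (conv-*-* (f i) (g (j ∸ i)) (separable f) (separable g) e)
                                          (trans (cong (λ x → f i * (g (j ∸ i) * x)) (separable-⊛ f g e))
                                                 (sym (ℚₚ.*-assoc (f i) (g (j ∸ i)) _)))) ⟩
    Σ< (suc j) (λ i → f i * g (j ∸ i) * separable (f ⊛ g) e)
      ≡⟨ ℚSums.Σ<-*ʳ (suc j) (separable (f ⊛ g) e) _ ⟨
    Σ< (suc j) (λ i → f i * g (j ∸ i)) * separable (f ⊛ g) e
      ≡⟨ cong (_* separable (f ⊛ g) e) (ℚSums.ΣL-applyUpTo (λ i → f i * g (j ∸ i)) id (suc j)) ⟨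
    (f ⊛ g) j * separable (f ⊛ g) e ∎
    where open P.≡-Reasoning

  separable-cong : ∀ {N} {f g : ℕ → ℚ} → (∀ m → f m ≡ g m) → separable {N} f ≗ separable g
  separable-cong f≗g [] = refl
  separable-cong f≗g (j ∷ e) = cong₂ _*_ (f≗g j) (separable-cong f≗g e)

  separable-oneSeries : ∀ {N} → separable {N} oneSeries ≗ δ
  separable-oneSeries [] = refl
  separable-oneSeries (zero ∷ e) = trans (ℚₚ.*-identityˡ _) (separable-oneSeries e)
  separable-oneSeries (suc j ∷ e) = ℚₚ.*-zeroˡ (separable oneSeries e)

  separable-prodBin : ∀ N D K (a : ℕ → ℚ) →
                      separable {N} (prodBin K a) ≗ InTruncated.S.Π< N D K (λ k → separable (binSeries (suc k) (a (suc k))))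
  separable-prodBin N D zero a = separable-oneSeries
  separable-prodBin N D (suc K) a e = trans (sym (separable-⊛ (prodBin K a) (binSeries (suc K) (a (suc K))) e))
                                            (conv-cong (separable-prodBin N D K a) (λ _ → refl) e)

  separable-prodBin-stable : ∀ {N} (a : ℕ → ℚ) D (e : Vec ℕ N) → vsum e ≤ D → separable (prodBin D a) e ≡ separable (prodBinCoeff a) e
  separable-prodBin-stable a D [] _ = refl
  separable-prodBin-stable a D (j ∷ e) le =
    cong₂ _*_ (prodBin-stable-≤ a (ℕₚ.≤-trans (ℕₚ.m≤m+n j (vsum e)) le))
              (separable-prodBin-stable a D e (ℕₚ.≤-trans (ℕₚ.m≤n+m (vsum e) j) le))

module PbarOfOnePart where
  open MultivariateSeries
  open SeriesConstructions
  open IndicatorSums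
  open SeparableSeries using (separable; conv-lift-inX₀)
  open ℚSums using (Σ<; ΣL)
  open Q using (0ℚ; 1ℚ; _+_; _*_)
  open P using (refl; sym; trans; cong; cong₂)

  scaled : ∀ {N} → ℕ → Subset N → Vec ℕ N
  scaled w [] = []
  scaled w (b ∷ s) = (if b then w else 0) ∷ scaled w s

  monomial : ∀ {N} → Vec ℕ N → Ser N
  monomial [] [] = 1ℚ
  monomial (v ∷ vs) (j ∷ e) = if v ≡ᵇ j then monomial vs e else 0ℚ

  nonempty : ∀ {N} → Subset N → Bool
  nonempty s = anyB (lookup s)

  pbar₁ : ∀ {N} → ℕ → Ser N
  pbar₁ {N} w e = ΣL (allSubsets N) (λ s → if nonempty s then monomial (scaled w s) e else 0ℚ)

  nonempty-true : ∀ {N} (s : Subset N) → nonempty (true ∷ s) ≡ true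
  nonempty-true s = AllFinFolds.anyB-suc (lookup (true ∷ s))

  nonempty-false : ∀ {N} (s : Subset N) → nonempty (false ∷ s) ≡ nonempty s
  nonempty-false s = AllFinFolds.anyB-suc (lookup (false ∷ s))

  ΣL-empty-monomial : ∀ {N} w (e : Vec ℕ N) →
                      ΣL (allSubsets N) (λ s → if nonempty s then 0ℚ else monomial (scaled w s) e) ≡ δ e
  ΣL-empty-monomial {zero} w [] = refl
  ΣL-empty-monomial {suc N} w (j ∷ e) = begin
    ΣL (allSubsets (suc N)) F
      ≡⟨ ΣL-allSubsets-suc F ⟩
    ΣL (allSubsets N) (λ s → F (true ∷ s)) + ΣL (allSubsets N) (λ s → F (false ∷ s))
      ≡⟨ cong₂ _+_ (trans (ℚSums.ΣL-cong (allSubsets N) with-first) (ℚSums.ΣL-zero (allSubsets N)))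
                   (ℚSums.ΣL-cong (allSubsets N) without-first) ⟩
    0ℚ + ΣL (allSubsets N) (λ s → if nonempty s then 0ℚ else (if 0 ≡ᵇ j then monomial (scaled w s) e else 0ℚ))
      ≡⟨ ℚₚ.+-identityˡ _ ⟩
    ΣL (allSubsets N) (λ s → if nonempty s then 0ℚ else (if 0 ≡ᵇ j then monomial (scaled w s) e else 0ℚ))
      ≡⟨ first-exponent j ⟩
    δ (j ∷ e) ∎
    where
    open P.≡-Reasoning
    F : Subset (suc N) → ℚ
    F s = if nonempty s then 0ℚ else monomial (scaled w s) (j ∷ e)
    with-first : ∀ s → F (true ∷ s) ≡ 0ℚ
    with-first s = cong (λ b → if b then 0ℚ else monomial (scaled w (true ∷ s)) (j ∷ e)) (nonempty-true s)
    without-first : ∀ s → F (false ∷ s) ≡ (if nonempty s then 0ℚ else (if 0 ≡ᵇ j then monomial (scaled w s) e else 0ℚ))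
    without-first s = cong (λ b → if b then 0ℚ else monomial (scaled w (false ∷ s)) (j ∷ e)) (nonempty-false s)
    first-exponent : ∀ j → ΣL (allSubsets N) (λ s → if nonempty s then 0ℚ else (if 0 ≡ᵇ j then monomial (scaled w s) e else 0ℚ)) ≡ δ (j ∷ e)
    first-exponent zero = ΣL-empty-monomial w e
    first-exponent (suc j) = trans (ℚSums.ΣL-cong (allSubsets N) (λ s → if-same (nonempty s))) (ℚSums.ΣL-zero (allSubsets N))
      where
      if-same : ∀ b → (if b then 0ℚ else 0ℚ) ≡ 0ℚ
      if-same true = refl
      if-same false = refl

  ΣL-monomial : ∀ {N} w (e : Vec ℕ N) → ΣL (allSubsets N) (λ s → monomial (scaled w s) e) ≡ pbar₁ w e + δ e
  ΣL-monomial {N} w e = trans (ℚSums.ΣL-cong (allSubsets N) (λ s → split (nonempty s) (monomial (scaled w s) e)))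
    (trans (ℚSums.ΣL-+ (allSubsets N) _ _) (cong (pbar₁ w e +_) (ΣL-empty-monomial w e)))
    where
    split : ∀ b x → x ≡ (if b then x else 0ℚ) + (if b then 0ℚ else x)
    split true x = sym (ℚₚ.+-identityʳ x)
    split false x = sym (ℚₚ.+-identityˡ x)

  pbar₁-∷ : ∀ {N} k j (e : Vec ℕ N) →
            pbar₁ k (j ∷ e) ≡ (if k ≡ᵇ j then pbar₁ k e + δ e else 0ℚ) + (if 0 ≡ᵇ j then pbar₁ k e else 0ℚ)
  pbar₁-∷ {N} k j e = begin
    pbar₁ k (j ∷ e)
      ≡⟨ ΣL-allSubsets-suc F ⟩
    ΣL (allSubsets N) (λ s → F (true ∷ s)) + ΣL (allSubsets N) (λ s → F (false ∷ s))
      ≡⟨ cong₂ _+_ (ℚSums.ΣL-cong (allSubsets N) with-first) (ℚSums.ΣL-cong (allSubsets N) without-first) ⟩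
    ΣL (allSubsets N) (λ s → if k ≡ᵇ j then monomial (scaled k s) e else 0ℚ)
      + ΣL (allSubsets N) (λ s → if 0 ≡ᵇ j then (if nonempty s then monomial (scaled k s) e else 0ℚ) else 0ℚ)
      ≡⟨ cong₂ _+_ (trans (ΣL-if (allSubsets N) (k ≡ᵇ j) _) (cong (λ x → if k ≡ᵇ j then x else 0ℚ) (ΣL-monomial k e)))
                   (ΣL-if (allSubsets N) (0 ≡ᵇ j) _) ⟩
    (if k ≡ᵇ j then pbar₁ k e + δ e else 0ℚ) + (if 0 ≡ᵇ j then pbar₁ k e else 0ℚ) ∎
    where
    open P.≡-Reasoning
    F : Subset (suc N) → ℚ
    F s = if nonempty s then monomial (scaled k s) (j ∷ e) else 0ℚ
    if-comm : ∀ b c x → (if b then (if c then x else 0ℚ) else 0ℚ) ≡ (if c then (if b then x else 0ℚ) else 0ℚ)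
    if-comm true c x = refl
    if-comm false true x = refl
    if-comm false false x = refl
    with-first : ∀ s → F (true ∷ s) ≡ (if k ≡ᵇ j then monomial (scaled k s) e else 0ℚ)
    with-first s = cong (λ b → if b then monomial (scaled k (true ∷ s)) (j ∷ e) else 0ℚ) (nonempty-true s)
    without-first : ∀ s → F (false ∷ s) ≡ (if 0 ≡ᵇ j then (if nonempty s then monomial (scaled k s) e else 0ℚ) else 0ℚ)
    without-first s = trans (cong (λ b → if b then monomial (scaled k (false ∷ s)) (j ∷ e) else 0ℚ) (nonempty-false s))
                            (if-comm (nonempty s) (0 ≡ᵇ j) _)

  pbar₁-suc : ∀ {N} k → pbar₁ {suc N} k ≗ (lift (pbar₁ k) ⊕ conv (x₀^ k) (δ ⊕ lift (pbar₁ k)))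
  pbar₁-suc {N} k (j ∷ e) =
    trans (pbar₁-∷ k j e) (trans (ℚₚ.+-comm (if k ≡ᵇ j then pbar₁ k e + δ e else 0ℚ) (if 0 ≡ᵇ j then pbar₁ k e else 0ℚ))
                                 (cong₂ _+_ (lift-if j) (sym shifted)))
    where
    lift-if : ∀ j → (if 0 ≡ᵇ j then pbar₁ k e else 0ℚ) ≡ lift (pbar₁ k) (j ∷ e)
    lift-if zero = refl
    lift-if (suc j) = refl
    constant-term : ∀ m → (δ ⊕ lift (pbar₁ k)) (m ∷ e) ≡ (if 0 ≡ᵇ m then pbar₁ k e + δ e else 0ℚ)
    constant-term zero = ℚₚ.+-comm (δ e) (pbar₁ k e)
    constant-term (suc m) = refl
    shifted : conv (x₀^ k) (δ ⊕ lift (pbar₁ k)) (j ∷ e) ≡ (if k ≡ᵇ j then pbar₁ k e + δ e else 0ℚ)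
    shifted = trans (conv-x₀^ k 0 (δ ⊕ lift (pbar₁ k)) (pbar₁ k e + δ e) j e constant-term)
                    (cong (λ z → if z ≡ᵇ j then pbar₁ k e + δ e else 0ℚ) (ℕₚ.+-identityʳ k))

  pbar₁-order : ∀ {N} w → OrderAtLeast {N} w (pbar₁ w)
  pbar₁-order {zero} w [] _ = refl
  pbar₁-order {suc N} w (j ∷ e) lt = trans (pbar₁-∷ w j e) (cong₂ _+_ below-w (rest j lt))
    where
    below-w : (if w ≡ᵇ j then pbar₁ w e + δ e else 0ℚ) ≡ 0ℚ
    below-w = cong (λ b → if b then pbar₁ w e + δ e else 0ℚ)
      (≢⇒≡ᵇ-false w j (λ w≡j → ℕₚ.<-irrefl (sym w≡j) (ℕₚ.≤-<-trans (ℕₚ.m≤m+n j (vsum e)) lt)))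
    rest : ∀ j → j ℕ.+ vsum e < w → (if 0 ≡ᵇ j then pbar₁ w e else 0ℚ) ≡ 0ℚ
    rest zero lt = pbar₁-order w e lt
    rest (suc j) _ = refl

  binomialSum-pbar₁ : ∀ N D k a → binomialSum N D D a (pbar₁ (suc k)) ≈[ D ] separable (binSeries (suc k) a)
  binomialSum-pbar₁ zero D k a [] _ = begin
    binomialSum zero D D a (pbar₁ (suc k)) []
      ≡⟨ InTruncated.binomialSum-apply zero D D a (pbar₁ (suc k)) [] ⟩
    Σ< (suc D) (λ x → binomℚ a x * pow zero D (pbar₁ (suc k)) x [])
      ≡⟨ ℚSums.Σ<-head D _ ⟩
    1ℚ * 1ℚ + Σ< D (λ x → binomℚ a (suc x) * (0ℚ * pow zero D (pbar₁ (suc k)) x []))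
      ≡⟨ cong (1ℚ +_) (ℚSums.Σ<-zero D (λ x _ → trans (cong (binomℚ a (suc x) *_) (ℚₚ.*-zeroˡ (pow zero D (pbar₁ (suc k)) x [])))
                                                  (ℚₚ.*-zeroʳ (binomℚ a (suc x))))) ⟩
    1ℚ ∎
    where open P.≡-Reasoning
  binomialSum-pbar₁ (suc N) D k a = begin
    binomialSum (suc N) D D a (pbar₁ (suc k))
      ≈⟨ InTruncated.binomialSum-cong (suc N) D D a (λ e _ → pbar₁-suc (suc k) e) ⟩
    binomialSum (suc N) D D a (u ⊕ conv v (δ ⊕ u))
      ≈⟨ InTruncated.B.binomialSum-* (suc N) D D a u v nilpotent ⟩
    conv (binomialSum (suc N) D D a u) (binomialSum (suc N) D D a v)
      ≈⟨ *-cong (λ e _ → sym (lift-binomialSum N D D a (pbar₁ (suc k)) e)) (≈-refl {binomialSum (suc N) D D a v}) ⟩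
    conv (lift (binomialSum N D D a (pbar₁ (suc k)))) (binomialSum (suc N) D D a v)
      ≈⟨ *-cong (lift-≈ D (binomialSum-pbar₁ N D k a)) (binomialSum-x₀^ N D k a) ⟩
    conv (lift (separable β)) (inX₀ β)
      ≈⟨ (λ e _ → conv-lift-inX₀ β e) ⟩
    separable β ∎
    where
    open CommutativeSemiring (Truncated (suc N) D) using (*-cong; setoid) renaming (refl to ≈-refl)
    open import Relation.Binary.Reasoning.Setoid setoid
    β = binSeries (suc k) a
    u v : Ser (suc N)
    u = lift (pbar₁ (suc k))
    v = x₀^ (suc k)
    nilpotent : ∀ t J → D < t ℕ.+ J → conv (pow (suc N) D u t) (pow (suc N) D v J) ≈[ D ] 𝟘
    nilpotent t J D<t+J e le =
      conv-order (suc k ℕ.* t) (suc k ℕ.* J) _ _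
        (InTruncated.^-order (suc N) D (suc k) u t (lift-order (suc k) (pbar₁ (suc k)) (pbar₁-order (suc k))))
        (InTruncated.^-order (suc N) D (suc k) v J (x₀^-order (suc k)))
        e (ℕₚ.<-≤-trans (ℕₚ.≤-<-trans le D<t+J) (ℕₚ.+-mono-≤ (ℕₚ.m≤n*m t (suc k)) (ℕₚ.m≤n*m J (suc k))))

module PbarAsProduct where
  open MultivariateSeries
  open IndicatorSums
  open PbarOfOnePart
  open AllFinFolds
  open ℚSums using (Σ<; ΣL)
  open Q using (0ℚ; _+_; _*_)
  open P using (refl; sym; trans; cong; cong₂)
  open import Relation.Nullary using (Dec; yes; no)

  -- A structural boolean ≤: unlike the builtin _≤ᵇ_, it unfolds on suc/suc.
  _≼_ : ℕ → ℕ → Bool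
  zero ≼ _ = true
  suc _ ≼ zero = false
  suc a ≼ suc b = a ≼ b

  ≤⇒≼ : ∀ {a b} → a ≤ b → (a ≼ b) ≡ true
  ≤⇒≼ z≤n = refl
  ≤⇒≼ (s≤s a≤b) = ≤⇒≼ a≤b

  >⇒≼-false : ∀ {a b} → b < a → (a ≼ b) ≡ false
  >⇒≼-false {suc a} {zero} _ = refl
  >⇒≼-false {suc a} {suc b} (s≤s b<a) = >⇒≼-false b<a

  _≼ᵛ_ : ∀ {N} → Vec ℕ N → Vec ℕ N → Bool
  [] ≼ᵛ [] = true
  (a ∷ v) ≼ᵛ (b ∷ e) = (a ≼ b) ∧ (v ≼ᵛ e)

  _∸ᵛ_ : ∀ {N} → Vec ℕ N → Vec ℕ N → Vec ℕ N
  [] ∸ᵛ [] = []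
  (b ∷ e) ∸ᵛ (a ∷ v) = (b ∸ a) ∷ (e ∸ᵛ v)

  +-≡ᵇ : ∀ a x c → ((a ℕ.+ x) ≡ᵇ c) ≡ ((a ≼ c) ∧ (x ≡ᵇ (c ∸ a)))
  +-≡ᵇ zero x c = refl
  +-≡ᵇ (suc a) x zero = refl
  +-≡ᵇ (suc a) x (suc c) = +-≡ᵇ a x c

  allB-+-≡ᵇ : ∀ {N} (v : Vec ℕ N) (x : Fin N → ℕ) (e : Vec ℕ N) →
              allB (λ i → (lookup v i ℕ.+ x i) ≡ᵇ lookup e i) ≡ ((v ≼ᵛ e) ∧ allB (λ i → x i ≡ᵇ lookup (e ∸ᵛ v) i))
  allB-+-≡ᵇ [] x [] = refl
  allB-+-≡ᵇ (a ∷ v) x (b ∷ e) = begin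
    allB (λ i → (lookup (a ∷ v) i ℕ.+ x i) ≡ᵇ lookup (b ∷ e) i)
      ≡⟨ allB-suc (λ i → (lookup (a ∷ v) i ℕ.+ x i) ≡ᵇ lookup (b ∷ e) i) ⟩
    ((a ℕ.+ x zero) ≡ᵇ b) ∧ allB (λ i → (lookup v i ℕ.+ x (suc i)) ≡ᵇ lookup e i)
      ≡⟨ cong₂ _∧_ (+-≡ᵇ a (x zero) b) (allB-+-≡ᵇ v (λ i → x (suc i)) e) ⟩
    ((a ≼ b) ∧ (x zero ≡ᵇ (b ∸ a))) ∧ ((v ≼ᵛ e) ∧ allB (λ i → x (suc i) ≡ᵇ lookup (e ∸ᵛ v) i))
      ≡⟨ ∧-interchange (a ≼ b) _ (v ≼ᵛ e) _ ⟩
    ((a ∷ v) ≼ᵛ (b ∷ e)) ∧ ((x zero ≡ᵇ (b ∸ a)) ∧ allB (λ i → x (suc i) ≡ᵇ lookup (e ∸ᵛ v) i))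
      ≡⟨ cong (((a ∷ v) ≼ᵛ (b ∷ e)) ∧_) (sym (allB-suc (λ i → x i ≡ᵇ lookup ((b ∷ e) ∸ᵛ (a ∷ v)) i))) ⟩
    ((a ∷ v) ≼ᵛ (b ∷ e)) ∧ allB (λ i → x i ≡ᵇ lookup ((b ∷ e) ∸ᵛ (a ∷ v)) i) ∎
    where open P.≡-Reasoning

  lookup-scaled : ∀ {N} w (s : Subset N) i → lookup (scaled w s) i ≡ (if lookup s i then w else 0)
  lookup-scaled w (b ∷ s) zero = refl
  lookup-scaled w (b ∷ s) (suc i) = lookup-scaled w s i

  conv-ifˡ : ∀ {N} b (f g : Ser N) e → conv (λ x → if b then f x else 0ℚ) g e ≡ (if b then conv f g e else 0ℚ)
  conv-ifˡ true f g e = refl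
  conv-ifˡ false f g e = conv-zeroˡ _ g (λ _ → refl) e

  conv-ΣLˡ : ∀ {N} {A : Set} (xs : List A) (F : A → Ser N) (g : Ser N) e →
             conv (λ x → ΣL xs (λ s → F s x)) g e ≡ ΣL xs (λ s → conv (F s) g e)
  conv-ΣLˡ [] F g e = conv-zeroˡ _ g (λ _ → refl) e
  conv-ΣLˡ (a ∷ xs) F g e = trans (conv-+ˡ (F a) (λ x → ΣL xs (λ s → F s x)) g e) (cong (conv (F a) g e +_) (conv-ΣLˡ xs F g e))

  conv-monomial : ∀ {N} (v : Vec ℕ N) (F : Ser N) e → conv (monomial v) F e ≡ (if v ≼ᵛ e then F (e ∸ᵛ v) else 0ℚ)
  conv-monomial [] F [] = ℚₚ.*-identityˡ (F [])
  conv-monomial (a ∷ v) F (j ∷ e) = trans (ℚSums.Σ<-cong′ (suc j) (λ i → trans (conv-ifˡ (a ≡ᵇ i) (monomial v) (slice (j ∸ i) F) e)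
                                                                           (cong (λ b → if b then conv (monomial v) (slice (j ∸ i) F) e else 0ℚ) (≡ᵇ-sym a i))))
                                          (select (a ℕ.≤? j))
    where
    select : Dec (a ≤ j) → Σ< (suc j) (λ i → if i ≡ᵇ a then conv (monomial v) (slice (j ∸ i) F) e else 0ℚ)
                           ≡ (if (a ≼ j) ∧ (v ≼ᵛ e) then F ((j ∸ a) ∷ (e ∸ᵛ v)) else 0ℚ)
    select (yes a≤j) rewrite ≤⇒≼ a≤j = trans (Σ<-select (suc j) a _ (s≤s a≤j)) (conv-monomial v (slice (j ∸ a) F) e)
    select (no a≰j) rewrite >⇒≼-false (ℕₚ.≰⇒> a≰j) = Σ<-select-out (suc j) a _ (ℕₚ.≰⇒> a≰j)

  pbarProduct : ∀ {N} → List ℕ → Ser N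
  pbarProduct [] = δ
  pbarProduct (w ∷ ws) = conv (pbar₁ w) (pbarProduct ws)

  edgelessColouring : ∀ {N} (ws : List ℕ) → Vec ℕ N → Vec (Subset N) (List.length ws) → Bool
  edgelessColouring ws e α =
    isProperSetColoring (List.length ws) (λ _ _ → false) α ∧ hasMonomial (List.length ws) (List.lookup ws) e α

  private
    allB-edges-false : ∀ {n N} (α : Vec (Subset N) n) →
      allB {n} (λ u → allB {n} (λ v → not false ∨ not (anyB (λ i → lookup (lookup α u) i ∧ lookup (lookup α v) i)))) ≡ true
    allB-edges-false {n} α = trans (allB-cong {n} (λ u → allB-true {n})) (allB-true {n})

  edgelessColouring-∷ : ∀ {N} w ws (e : Vec ℕ N) s α →
    edgelessColouring (w ∷ ws) e (s ∷ α) ≡ (nonempty s ∧ ((scaled w s ≼ᵛ e) ∧ edgelessColouring ws (e ∸ᵛ scaled w s) α))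
  edgelessColouring-∷ w ws e s α = begin
    edgelessColouring (w ∷ ws) e (s ∷ α)
      ≡⟨ cong₂ _∧_ (cong₂ _∧_ (allB-suc (λ v → anyB (lookup (lookup (s ∷ α) v)))) (allB-edges-false (s ∷ α))) monomial-∷ ⟩
    ((nonempty s ∧ allNonempty) ∧ true) ∧ ((scaled w s ≼ᵛ e) ∧ rest)
      ≡⟨ rearrange (nonempty s) allNonempty (scaled w s ≼ᵛ e) rest ⟩
    nonempty s ∧ ((scaled w s ≼ᵛ e) ∧ ((allNonempty ∧ true) ∧ rest))
      ≡⟨ cong (λ b → nonempty s ∧ ((scaled w s ≼ᵛ e) ∧ ((allNonempty ∧ b) ∧ rest))) (sym (allB-edges-false α)) ⟩
    nonempty s ∧ ((scaled w s ≼ᵛ e) ∧ edgelessColouring ws (e ∸ᵛ scaled w s) α) ∎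
    where
    open P.≡-Reasoning
    allNonempty = allB (λ v → anyB (lookup (lookup α v)))
    rest = hasMonomial (List.length ws) (List.lookup ws) (e ∸ᵛ scaled w s) α
    colourWeight : Fin _ → ℕ
    colourWeight i = sumFinℕ (λ v → if lookup (lookup α v) i then List.lookup ws v else 0)
    monomial-∷ : hasMonomial (suc (List.length ws)) (List.lookup (w ∷ ws)) e (s ∷ α) ≡ ((scaled w s ≼ᵛ e) ∧ rest)
    monomial-∷ = trans (allB-cong (λ i → cong (_≡ᵇ lookup e i)
                         (trans (sumFinℕ-suc (λ v → if lookup (lookup (s ∷ α) v) i then List.lookup (w ∷ ws) v else 0))
                                (cong (ℕ._+ colourWeight i) (sym (lookup-scaled w s i))))))
                       (allB-+-≡ᵇ (scaled w s) colourWeight e)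
    rearrange : ∀ a b c d → (((a ∧ b) ∧ true) ∧ (c ∧ d)) ≡ (a ∧ (c ∧ ((b ∧ true) ∧ d)))
    rearrange false b c d = refl
    rearrange true true c d = refl
    rearrange true false c d = sym (Data.Bool.Properties.∧-zeroʳ c)
      where import Data.Bool.Properties

  𝟙-allB-0≡δ : ∀ {N} (e : Vec ℕ N) → 𝟙 (allB (λ i → 0 ≡ᵇ lookup e i)) ≡ δ e
  𝟙-allB-0≡δ [] = refl
  𝟙-allB-0≡δ (zero ∷ e) = trans (cong 𝟙 (allB-suc (λ i → 0 ≡ᵇ lookup (zero ∷ e) i))) (𝟙-allB-0≡δ e)
  𝟙-allB-0≡δ (suc j ∷ e) = cong 𝟙 (allB-suc (λ i → 0 ≡ᵇ lookup (suc j ∷ e) i))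

  edgeless-kromCoeff : ∀ {N} (ws : List ℕ) (e : Vec ℕ N) →
                       ℕtoℚ (kromCoeffRaw (List.length ws) (λ _ _ → false) (List.lookup ws) e) ≡ pbarProduct ws e
  edgeless-kromCoeff {N} [] e = trans (ℕtoℚ-countB (edgelessColouring [] e) (allVecs (allSubsets N) 0))
    (trans (ℚₚ.+-identityʳ (𝟙 (allB (λ i → 0 ≡ᵇ lookup e i)))) (𝟙-allB-0≡δ e))
  edgeless-kromCoeff {N} (w ∷ ws) e = begin
    ℕtoℚ (countB (edgelessColouring (w ∷ ws) e) (allVecs S (suc n)))
      ≡⟨ ℕtoℚ-countB _ (allVecs S (suc n)) ⟩
    ΣL (allVecs S (suc n)) (λ α → 𝟙 (edgelessColouring (w ∷ ws) e α))
      ≡⟨ ℚSums.ΣL-allVecs-suc S n _ ⟩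
    ΣL S (λ s → ΣL (allVecs S n) (λ α → 𝟙 (edgelessColouring (w ∷ ws) e (s ∷ α))))
      ≡⟨ ℚSums.ΣL-cong S (λ s → ℚSums.ΣL-cong (allVecs S n) (λ α → cong 𝟙 (edgelessColouring-∷ w ws e s α))) ⟩
    ΣL S (λ s → ΣL (allVecs S n) (λ α → 𝟙 (nonempty s ∧ (fits s ∧ edgelessColouring ws (rest s) α))))
      ≡⟨ ℚSums.ΣL-cong S (λ s → trans (ΣL-𝟙-∧ (allVecs S n) (nonempty s) _)
                                   (cong (λ x → if nonempty s then x else 0ℚ) (ΣL-𝟙-∧ (allVecs S n) (fits s) _))) ⟩
    ΣL S (λ s → if nonempty s then (if fits s then ΣL (allVecs S n) (λ α → 𝟙 (edgelessColouring ws (rest s) α)) else 0ℚ) else 0ℚ)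
      ≡⟨ ℚSums.ΣL-cong S (λ s → cong (λ x → if nonempty s then (if fits s then x else 0ℚ) else 0ℚ)
                                   (trans (sym (ℕtoℚ-countB _ (allVecs S n))) (edgeless-kromCoeff ws (rest s)))) ⟩
    ΣL S (λ s → if nonempty s then (if fits s then pbarProduct ws (rest s) else 0ℚ) else 0ℚ)
      ≡⟨ ℚSums.ΣL-cong S (λ s → trans (conv-ifˡ (nonempty s) (monomial (scaled w s)) (pbarProduct ws) e)
                                   (cong (λ x → if nonempty s then x else 0ℚ) (conv-monomial (scaled w s) (pbarProduct ws) e))) ⟨
    ΣL S (λ s → conv (λ x → if nonempty s then monomial (scaled w s) x else 0ℚ) (pbarProduct ws) e)
      ≡⟨ conv-ΣLˡ S (λ s x → if nonempty s then monomial (scaled w s) x else 0ℚ) (pbarProduct ws) e ⟨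
    conv (pbar₁ w) (pbarProduct ws) e ∎
    where
    open P.≡-Reasoning
    S = allSubsets N
    n = List.length ws
    fits : Subset N → Bool
    fits s = scaled w s ≼ᵛ e
    rest : Subset N → Vec ℕ N
    rest s = e ∸ᵛ scaled w s

module PbarExpansion where
  open MultivariateSeries
  open SeriesConstructions
  open PbarOfOnePart using (pbar₁; pbar₁-order; binomialSum-pbar₁)
  open PbarAsProduct using (pbarProduct; edgeless-kromCoeff)
  open SeparableSeries using (separable; separable-prodBin; separable-prodBin-stable)
  open ℚSums using (ΣL)
  open Q using (0ℚ; _+_; _*_)
  open P using (refl; sym; trans; cong)
  open import Data.Bool using (T)
  open import Data.Bool.Properties using (T?)

  pbarProduct-++ : ∀ {N} xs ys → pbarProduct {N} (xs ++ ys) ≗ conv (pbarProduct xs) (pbarProduct ys)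
  pbarProduct-++ [] ys e = sym (conv-δˡ (pbarProduct ys) e)
  pbarProduct-++ (x ∷ xs) ys e =
    trans (conv-cong (λ _ → refl) (pbarProduct-++ xs ys) e) (sym (conv-assoc (pbar₁ x) (pbarProduct xs) (pbarProduct ys) e))

  module _ (N D : ℕ) where
    open InTruncated N D using (module S; _^_)

    ΠL-cong-≗ : ∀ {K : Set} {A B : K → Ser N} → (∀ k → A k ≗ B k) → ∀ ks → S.ΠL ks A ≗ S.ΠL ks B
    ΠL-cong-≗ A≗B [] e = refl
    ΠL-cong-≗ A≗B (k ∷ ks) = conv-cong (A≗B k) (ΠL-cong-≗ A≗B ks)

    pbarProduct-concatMap : ∀ {K : Set} (g : K → List ℕ) ks → pbarProduct (concatMap g ks) ≗ S.ΠL ks (λ k → pbarProduct (g k))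
    pbarProduct-concatMap g [] e = refl
    pbarProduct-concatMap g (k ∷ ks) e =
      trans (pbarProduct-++ (g k) (concatMap g ks) e) (conv-cong (λ _ → refl) (pbarProduct-concatMap g ks) e)

    pbarProduct-replicate : ∀ m w → pbarProduct (List.replicate m w) ≗ pbar₁ w ^ m
    pbarProduct-replicate zero w e = refl
    pbarProduct-replicate (suc m) w = conv-cong (λ _ → refl) (pbarProduct-replicate m w)

    pbarOfMultiplicities : Vec ℕ D → Ser N
    pbarOfMultiplicities λ′ = S.ΠL (allFin D) (λ k → pbar₁ (suc (toℕ k)) ^ lookup λ′ k)

    pbarProduct-partWeights : ∀ λ′ → pbarProduct (partWeights λ′) ≗ pbarOfMultiplicities λ′
    pbarProduct-partWeights λ′ e =
      trans (pbarProduct-concatMap (λ k → List.replicate (lookup λ′ k) (suc (toℕ k))) (allFin D) e)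
            (ΠL-cong-≗ (λ k → pbarProduct-replicate (lookup λ′ k) (suc (toℕ k))) (allFin D) e)

    ΠL-order : ∀ {K : Set} (m : K → ℕ) (X : K → Ser N) → (∀ k → OrderAtLeast (m k) (X k)) → ∀ ks →
               OrderAtLeast (foldr (λ k s → m k ℕ.+ s) 0 ks) (S.ΠL ks X)
    ΠL-order m X X≥m [] e ()
    ΠL-order m X X≥m (k ∷ ks) = conv-order (m k) _ (X k) _ (X≥m k) (ΠL-order m X X≥m ks)

    pbarOfMultiplicities-order : ∀ λ′ → OrderAtLeast (partSize λ′) (pbarOfMultiplicities λ′)
    pbarOfMultiplicities-order λ′ = ΠL-order (λ k → suc (toℕ k) ℕ.* lookup λ′ k) _
      (λ k → InTruncated.^-order N D (suc (toℕ k)) (pbar₁ (suc (toℕ k))) (lookup λ′ k) (pbar₁-order (suc (toℕ k)))) (allFin D)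

  ΣL-filter : ∀ {A : Set} (p : A → Bool) (F : A → ℚ) xs → (∀ x → p x ≡ false → F x ≡ 0ℚ) →
              ΣL (List.filter (λ x → T? (p x)) xs) F ≡ ΣL xs F
  ΣL-filter p F [] _ = refl
  ΣL-filter p F (x ∷ xs) F≡0 with p x in px
  ... | true = cong (F x +_) (ΣL-filter p F xs F≡0)
  ... | false = trans (ΣL-filter p F xs F≡0) (sym (trans (cong (_+ ΣL xs F) (F≡0 x px)) (ℚₚ.+-identityˡ _)))

  ≤ᵇ-false⇒> : ∀ m n → (m ℕ.≤ᵇ n) ≡ false → n < m
  ≤ᵇ-false⇒> m n eq = ℕₚ.≰⇒> (λ m≤n → P.subst T eq (ℕₚ.≤⇒≤ᵇ m≤n))

  module _ {N} (e : Vec ℕ N) (a : ℕ → ℚ) where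
    private
      D = vsum e
      Vs = allVecs (List.upTo (suc D)) D
    open InTruncated N D using (module S; _^_)

    binomials : Vec ℕ D → ℚ
    binomials λ′ = prodℚ (map (λ k → binomℚ (a (suc (toℕ k))) (lookup λ′ k)) (allFin D))

    binomialTerm : Fin D → ℕ → Ser N
    binomialTerm k x = conv (scalar (binomℚ (a (suc (toℕ k))) x)) (pbar₁ (suc (toℕ k)) ^ x)

    scalar-prodℚ : ∀ {K : Set} (c : K → ℚ) ks → scalar (prodℚ (map c ks)) ≈[ D ] S.ΠL ks (λ k → scalar (c k))
    scalar-prodℚ c [] e _ = ℚₚ.*-identityˡ (δ e)
    scalar-prodℚ c (k ∷ ks) = ≈-trans (λ e _ → scalar-* (c k) (prodℚ (map c ks)) e)
                                      (*-cong {scalar (c k)} {scalar (c k)} ≈-refl (scalar-prodℚ c ks))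
      where open CommutativeSemiring (Truncated N D) using (*-cong) renaming (refl to ≈-refl; trans to ≈-trans)

    binomials*pbar : ∀ λ′ → binomials λ′ * pbarOfMultiplicities N D λ′ e ≡ S.ΠL (allFin D) (λ k → binomialTerm k (lookup λ′ k)) e
    binomials*pbar λ′ = trans (sym (conv-scalarˡ (binomials λ′) (pbarOfMultiplicities N D λ′) e))
      (≈-trans (*-cong {scalar (binomials λ′)} {S.ΠL (allFin D) (λ k → scalar (binomℚ (a (suc (toℕ k))) (lookup λ′ k)))}
                       (scalar-prodℚ _ (allFin D)) (≈-refl {pbarOfMultiplicities N D λ′}))
               (≈-sym (S.ΠL-* (allFin D) _ _)) e ℕₚ.≤-refl)
      where open CommutativeSemiring (Truncated N D) using (*-cong) renaming (refl to ≈-refl; sym to ≈-sym; trans to ≈-trans)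

    ΣL-binomialTerms : S.ΣL Vs (λ λ′ → S.ΠL (allFin D) (λ k → binomialTerm k (lookup λ′ k))) ≈[ D ] separable (prodBin D a)
    ΣL-binomialTerms = begin
      S.ΣL Vs (λ λ′ → S.ΠL (allFin D) (λ k → binomialTerm k (lookup λ′ k)))
        ≈⟨ S.ΣL-allVecs-ΠL (List.upTo (suc D)) D binomialTerm ⟩
      S.ΠL (allFin D) (λ k → S.ΣL (List.upTo (suc D)) (binomialTerm k))
        ≈⟨ S.ΠL-cong (allFin D) (λ k → S.ΣL-applyUpTo (binomialTerm k) id (suc D)) ⟩
      S.ΠL (allFin D) (λ k → binomialSum N D D (a (suc (toℕ k))) (pbar₁ (suc (toℕ k))))
        ≈⟨ S.ΠL-cong (allFin D) (λ k → binomialSum-pbar₁ N D (toℕ k) (a (suc (toℕ k)))) ⟩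
      S.ΠL (allFin D) (λ k → separable (binSeries (suc (toℕ k)) (a (suc (toℕ k)))))
        ≈⟨ S.ΠL-allFin D (λ k → separable (binSeries (suc k) (a (suc k)))) ⟩
      S.Π< D (λ k → separable (binSeries (suc k) (a (suc k))))
        ≈⟨ (λ e′ _ → sym (separable-prodBin N D D a e′)) ⟩
      separable (prodBin D a) ∎
      where open import Relation.Binary.Reasoning.Setoid (CommutativeSemiring.setoid (Truncated N D))

    pbar-expansion : sumℚ (map (λ λ′ → binomials λ′ * ℕtoℚ (pbarCoeff λ′ e)) (partitionsUpTo D)) ≡ separable (prodBinCoeff a) e
    pbar-expansion = begin
      ΣL (partitionsUpTo D) (λ λ′ → binomials λ′ * ℕtoℚ (pbarCoeff λ′ e))
        ≡⟨ ℚSums.ΣL-cong (partitionsUpTo D) (λ λ′ → cong (binomials λ′ *_)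
             (trans (edgeless-kromCoeff (partWeights λ′) e) (pbarProduct-partWeights N D λ′ e))) ⟩
      ΣL (partitionsUpTo D) (λ λ′ → binomials λ′ * pbarOfMultiplicities N D λ′ e)
        ≡⟨ ΣL-filter (λ λ′ → partSize λ′ ℕ.≤ᵇ D) _ Vs too-large-vanishes ⟩
      ΣL Vs (λ λ′ → binomials λ′ * pbarOfMultiplicities N D λ′ e)
        ≡⟨ ℚSums.ΣL-cong Vs binomials*pbar ⟩
      ΣL Vs (λ λ′ → S.ΠL (allFin D) (λ k → binomialTerm k (lookup λ′ k)) e)
        ≡⟨ InTruncated.ΣL-apply N D Vs _ e ⟨
      S.ΣL Vs (λ λ′ → S.ΠL (allFin D) (λ k → binomialTerm k (lookup λ′ k))) e
        ≡⟨ ΣL-binomialTerms e ℕₚ.≤-refl ⟩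
      separable (prodBin D a) e
        ≡⟨ separable-prodBin-stable a D e ℕₚ.≤-refl ⟩
      separable (prodBinCoeff a) e ∎
      where
      open P.≡-Reasoning
      too-large-vanishes : ∀ λ′ → (partSize λ′ ℕ.≤ᵇ D) ≡ false → binomials λ′ * pbarOfMultiplicities N D λ′ e ≡ 0ℚ
      too-large-vanishes λ′ large = trans (cong (binomials λ′ *_) (pbarOfMultiplicities-order N D λ′ e (≤ᵇ-false⇒> (partSize λ′) D large)))
                                          (ℚₚ.*-zeroʳ (binomials λ′))

module InclusionExclusion where
  open SeparableSeries using (separable)
  open IndicatorSums
  open AllFinFolds
  open ℚSums using (ΣL)
  open Q using (0ℚ; _+_; _*_; -_)
  open P using (refl; sym; trans; cong; cong₂)
  open P.≡-Reasoning
  open import Data.Rational.Solver using (module +-*-Solver)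
  import Data.Bool.Properties as Boolₚ
  import Data.Vec.Properties as Vecₚ

  size : ∀ {n} → Subset n → ℕ
  size {n} W = countB (lookup W) (allFin n)

  size-≤ : ∀ n (W : Subset n) → size W ≤ n
  size-≤ zero [] = z≤n
  size-≤ (suc n) (b ∷ W) rewrite countB-allFin-suc (lookup (b ∷ W)) with b
  ... | true = s≤s (size-≤ n W)
  ... | false = ℕₚ.m≤n⇒m≤1+n (size-≤ n W)

  signℚ-suc-∸ : ∀ n c → c ≤ n → signℚ (suc n ∸ c) ≡ - signℚ (n ∸ c)
  signℚ-suc-∸ n c c≤n rewrite ℕₚ.+-∸-assoc 1 c≤n = refl

  covers : ∀ {n} → Subset n → (Fin n → Bool) → Bool
  covers W R = allB (λ v → lookup W v ∨ R v)

  ΣL-sign-covers : ∀ n (R : Fin n → Bool) →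
                   ΣL (allSubsets n) (λ W → 𝟙 (covers W R) * signℚ (n ∸ size W)) ≡ 𝟙 (allB (λ v → not (R v)))
  ΣL-sign-covers zero R = refl
  ΣL-sign-covers (suc n) R = begin
    ΣL (allSubsets (suc n)) term
      ≡⟨ ΣL-allSubsets-suc term ⟩
    ΣL (allSubsets n) (λ W → term (true ∷ W)) + ΣL (allSubsets n) (λ W → term (false ∷ W))
      ≡⟨ cong₂ _+_ (ℚSums.ΣL-cong (allSubsets n) with-first) (ℚSums.ΣL-cong (allSubsets n) without-first) ⟩
    ΣL (allSubsets n) term′ + ΣL (allSubsets n) (λ W → 𝟙 (R zero ∧ covers W R′) * - signℚ (n ∸ size W))
      ≡⟨ cases (R zero) ⟩
    𝟙 (not (R zero) ∧ allB (λ v → not (R′ v)))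
      ≡⟨ cong 𝟙 (allB-suc (λ v → not (R v))) ⟨
    𝟙 (allB (λ v → not (R v))) ∎
    where
    R′ : Fin n → Bool
    R′ v = R (suc v)
    term : Subset (suc n) → ℚ
    term W = 𝟙 (covers W R) * signℚ (suc n ∸ size W)
    term′ : Subset n → ℚ
    term′ W = 𝟙 (covers W R′) * signℚ (n ∸ size W)
    with-first : ∀ W → term (true ∷ W) ≡ term′ W
    with-first W = cong₂ (λ x c → 𝟙 x * signℚ (suc n ∸ c)) (allB-suc (λ v → lookup (true ∷ W) v ∨ R v))
                                                            (countB-allFin-suc (lookup (true ∷ W)))
    without-first : ∀ W → term (false ∷ W) ≡ 𝟙 (R zero ∧ covers W R′) * - signℚ (n ∸ size W)
    without-first W = cong₂ (λ x y → 𝟙 x * y) (allB-suc (λ v → lookup (false ∷ W) v ∨ R v))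
      (trans (cong (λ c → signℚ (suc n ∸ c)) (countB-allFin-suc (lookup (false ∷ W)))) (signℚ-suc-∸ n (size W) (size-≤ n W)))
    cases : ∀ b → ΣL (allSubsets n) term′ + ΣL (allSubsets n) (λ W → 𝟙 (b ∧ covers W R′) * - signℚ (n ∸ size W))
                  ≡ 𝟙 (not b ∧ allB (λ v → not (R′ v)))
    cases true = trans (sym (ℚSums.ΣL-+ (allSubsets n) term′ (λ W → 𝟙 (covers W R′) * - signℚ (n ∸ size W))))
      (trans (ℚSums.ΣL-cong (allSubsets n) (λ W → solve 2 (λ i s → i :* s :+ i :* (:- s) := con 0ℚ) refl (𝟙 (covers W R′)) (signℚ (n ∸ size W))))
             (ℚSums.ΣL-zero (allSubsets n)))
      where open +-*-Solver
    cases false = trans (cong (ΣL (allSubsets n) term′ +_) no-terms) (trans (ℚₚ.+-identityʳ _) (ΣL-sign-covers n R′))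
      where
      no-terms : ΣL (allSubsets n) (λ W → 𝟙 false * - signℚ (n ∸ size W)) ≡ 0ℚ
      no-terms = trans (ℚSums.ΣL-cong (allSubsets n) (λ W → ℚₚ.*-zeroˡ (- signℚ (n ∸ size W)))) (ℚSums.ΣL-zero (allSubsets n))

  ΣL-colourings-zero : ∀ n (f : Vec (Subset 0) n → ℚ) → ΣL (allVecs (allSubsets 0) n) f ≡ f (Vec.replicate n [])
  ΣL-colourings-zero zero f = ℚₚ.+-identityʳ (f [])
  ΣL-colourings-zero (suc n) f = trans (ℚSums.ΣL-allVecs-suc (allSubsets 0) n f)
    (trans (ℚₚ.+-identityʳ _) (ΣL-colourings-zero n (λ α → f ([] ∷ α))))

  ΣL-colourings-suc : ∀ {N} n (f : Vec (Subset (suc N)) n → ℚ) →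
                      ΣL (allVecs (allSubsets (suc N)) n) f
                      ≡ ΣL (allSubsets n) (λ S → ΣL (allVecs (allSubsets N) n) (λ α → f (Vec.zipWith _∷_ S α)))
  ΣL-colourings-suc {N} zero f = sym (ℚₚ.+-identityʳ _)
  ΣL-colourings-suc {N} (suc n) f = begin
    ΣL (allVecs Cs′ (suc n)) f
      ≡⟨ ℚSums.ΣL-allVecs-suc Cs′ n f ⟩
    ΣL Cs′ (λ s → ΣL (allVecs Cs′ n) (λ α → f (s ∷ α)))
      ≡⟨ ℚSums.ΣL-cong Cs′ (λ s → ΣL-colourings-suc n (λ α → f (s ∷ α))) ⟩
    ΣL Cs′ (λ s → g s)
      ≡⟨ ΣL-allSubsets-suc g ⟩
    ΣL Cs (λ s → g (true ∷ s)) + ΣL Cs (λ s → g (false ∷ s))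
      ≡⟨ cong₂ _+_ (first-vertex true) (first-vertex false) ⟩
    ΣL (allSubsets n) (λ S → ΣL (allVecs Cs (suc n)) (λ α → f (Vec.zipWith _∷_ (true ∷ S) α)))
      + ΣL (allSubsets n) (λ S → ΣL (allVecs Cs (suc n)) (λ α → f (Vec.zipWith _∷_ (false ∷ S) α)))
      ≡⟨ ΣL-allSubsets-suc (λ S → ΣL (allVecs Cs (suc n)) (λ α → f (Vec.zipWith _∷_ S α))) ⟨
    ΣL (allSubsets (suc n)) (λ S → ΣL (allVecs Cs (suc n)) (λ α → f (Vec.zipWith _∷_ S α))) ∎
    where
    Cs = allSubsets N
    Cs′ = allSubsets (suc N)
    g : Subset (suc N) → ℚ
    g s = ΣL (allSubsets n) (λ S → ΣL (allVecs Cs n) (λ α → f (s ∷ Vec.zipWith _∷_ S α)))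
    first-vertex : ∀ b → ΣL Cs (λ s → g (b ∷ s)) ≡ ΣL (allSubsets n) (λ S → ΣL (allVecs Cs (suc n)) (λ α → f (Vec.zipWith _∷_ (b ∷ S) α)))
    first-vertex b = trans (ℚSums.ΣL-comm Cs (allSubsets n) (λ s S → ΣL (allVecs Cs n) (λ α → f ((b ∷ s) ∷ Vec.zipWith _∷_ S α))))
      (ℚSums.ΣL-cong (allSubsets n) (λ S → sym (ℚSums.ΣL-allVecs-suc Cs n (λ α → f (Vec.zipWith _∷_ (b ∷ S) α)))))

  module _ (G : WGraph) where
    open WGraph G hiding (sym)

    _minus_ : (Fin n → Bool) → Subset n → Fin n → Bool
    (R minus S) v = R v ∧ not (lookup S v)

    nonemptyOn : ∀ {N} → (Fin n → Bool) → Vec (Subset N) n → Bool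
    nonemptyOn R α = allB (λ v → not (R v) ∨ anyB (λ i → lookup (lookup α v) i))

    disjointOnEdges : ∀ {N} → Vec (Subset N) n → Bool
    disjointOnEdges α = allB (λ u → allB (λ v → not (adj u v) ∨ not (anyB (λ i → lookup (lookup α u) i ∧ lookup (lookup α v) i))))

    relaxedColouring : ∀ {N} → (Fin n → Bool) → Vec ℕ N → Vec (Subset N) n → Bool
    relaxedColouring R e α = (nonemptyOn R α ∧ disjointOnEdges α) ∧ hasMonomial n ω e α

    relaxedCount : ∀ {N} → (Fin n → Bool) → Vec ℕ N → ℚ
    relaxedCount {N} R e = ΣL (allVecs (allSubsets N) n) (λ α → 𝟙 (relaxedColouring R e α))

    sign : Subset n → ℚ
    sign W = signℚ (n ∸ card G W)

    indep : Subset n → ℕ → ℚ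
    indep W m = ℕtoℚ (indepCoeff G W m)

    inclusionExclusion : ∀ {N} → (Fin n → Bool) → Vec ℕ N → ℚ
    inclusionExclusion R e = ΣL (allSubsets n) (λ W → 𝟙 (covers W R) * (sign W * separable (indep W) e))

    module _ {N} (S : Subset n) (α : Vec (Subset N) n) where
      private
        Sα : Vec (Subset (suc N)) n
        Sα = Vec.zipWith _∷_ S α
        lookup-Sα : ∀ v → lookup Sα v ≡ (lookup S v ∷ lookup α v)
        lookup-Sα v = Vecₚ.lookup-zipWith _∷_ v S α

      nonemptyOn-∷ : ∀ R → nonemptyOn R Sα ≡ nonemptyOn (R minus S) α
      nonemptyOn-∷ R = allB-cong (λ v → trans (cong (λ c → not (R v) ∨ anyB (lookup c)) (lookup-Sα v))
        (trans (cong (not (R v) ∨_) (anyB-suc (lookup (lookup S v ∷ lookup α v)))) (not-∨-∨ (R v) (lookup S v) _)))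
        where
        not-∨-∨ : ∀ r s x → (not r ∨ (s ∨ x)) ≡ (not (r ∧ not s) ∨ x)
        not-∨-∨ true true x = refl
        not-∨-∨ true false x = refl
        not-∨-∨ false s x = refl

      disjointOnEdges-∷ : disjointOnEdges Sα ≡ (independentB G S ∧ disjointOnEdges α)
      disjointOnEdges-∷ = begin
        disjointOnEdges Sα
          ≡⟨ allB-cong (λ u → trans (allB-cong (λ v → split u v)) (allB-∧ (inS u) (inα u))) ⟩
        allB (λ u → allB (inS u) ∧ allB (inα u))
          ≡⟨ allB-∧ (λ u → allB (inS u)) (λ u → allB (inα u)) ⟩
        allB (λ u → allB (inS u)) ∧ disjointOnEdges α
          ≡⟨ cong (_∧ disjointOnEdges α) (allB-cong (λ u → allB-cong (λ v → edge-rule (adj u v) (lookup S u) (lookup S v)))) ⟩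
        independentB G S ∧ disjointOnEdges α ∎
        where
        inS inα : Fin n → Fin n → Bool
        inS u v = not (adj u v) ∨ not (lookup S u ∧ lookup S v)
        inα u v = not (adj u v) ∨ not (anyB (λ i → lookup (lookup α u) i ∧ lookup (lookup α v) i))
        not-∨-distrib : ∀ a x y → (not a ∨ not (x ∨ y)) ≡ ((not a ∨ not x) ∧ (not a ∨ not y))
        not-∨-distrib true true y = refl
        not-∨-distrib true false y = refl
        not-∨-distrib false x y = refl
        split : ∀ u v → (not (adj u v) ∨ not (anyB (λ i → lookup (lookup Sα u) i ∧ lookup (lookup Sα v) i))) ≡ (inS u v ∧ inα u v)
        split u v = trans (cong₂ (λ c c′ → not (adj u v) ∨ not (anyB (λ i → lookup c i ∧ lookup c′ i))) (lookup-Sα u) (lookup-Sα v))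
          (trans (cong (λ b → not (adj u v) ∨ not b) (anyB-suc (λ i → lookup (lookup S u ∷ lookup α u) i ∧ lookup (lookup S v ∷ lookup α v) i)))
                 (not-∨-distrib (adj u v) _ _))
        edge-rule : ∀ a x y → (not a ∨ not (x ∧ y)) ≡ not (x ∧ y ∧ a)
        edge-rule a false y = Boolₚ.∨-zeroʳ (not a)
        edge-rule a true false = Boolₚ.∨-zeroʳ (not a)
        edge-rule a true true = Boolₚ.∨-identityʳ (not a)

      hasMonomial-∷ : ∀ e₀ (e : Vec ℕ N) → hasMonomial n ω (e₀ ∷ e) Sα ≡ ((weightOf G S ≡ᵇ e₀) ∧ hasMonomial n ω e α)
      hasMonomial-∷ e₀ e = trans (allB-suc (λ i → sumFinℕ (λ v → if lookup (lookup Sα v) i then ω v else 0) ≡ᵇ lookup (e₀ ∷ e) i))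
        (cong₂ _∧_ (cong (_≡ᵇ e₀) (sumFinℕ-cong (λ v → cong (λ c → if lookup c zero then ω v else 0) (lookup-Sα v))))
                   (allB-cong (λ i → cong (_≡ᵇ lookup e i) (sumFinℕ-cong (λ v → cong (λ c → if lookup c (suc i) then ω v else 0) (lookup-Sα v))))))

      relaxedColouring-∷ : ∀ R e₀ (e : Vec ℕ N) →
        relaxedColouring R (e₀ ∷ e) Sα ≡ ((independentB G S ∧ (weightOf G S ≡ᵇ e₀)) ∧ relaxedColouring (R minus S) e α)
      relaxedColouring-∷ R e₀ e =
        trans (cong₂ _∧_ (cong₂ _∧_ (nonemptyOn-∷ R) disjointOnEdges-∷) (hasMonomial-∷ e₀ e))
              (solve 5 (λ r i p w h → (r ⊕ (i ⊕ p)) ⊕ (w ⊕ h) ⊜ (i ⊕ w) ⊕ ((r ⊕ p) ⊕ h)) refl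
                 (nonemptyOn (R minus S) α) (independentB G S) (disjointOnEdges α) (weightOf G S ≡ᵇ e₀) (hasMonomial n ω e α))
        where open import Algebra.Solver.CommutativeMonoid Boolₚ.∧-commutativeMonoid

    covers-minus : ∀ (W S : Subset n) R → covers W (R minus S) ≡ (covers W R ∧ subsetB G S W)
    covers-minus W S R = trans (allB-cong (λ v → ∨-minus (lookup W v) (R v) (lookup S v)))
                               (allB-∧ (λ v → lookup W v ∨ R v) (λ v → not (lookup S v) ∨ lookup W v))
      where
      ∨-minus : ∀ w r s → (w ∨ (r ∧ not s)) ≡ ((w ∨ r) ∧ (not s ∨ w))
      ∨-minus true r true = refl
      ∨-minus true r false = refl
      ∨-minus false true true = refl
      ∨-minus false true false = refl
      ∨-minus false false s = refl

    relaxedCount≡inclusionExclusion : ∀ {N} R (e : Vec ℕ N) → relaxedCount R e ≡ inclusionExclusion R e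
    relaxedCount≡inclusionExclusion {zero} R [] = begin
      relaxedCount R []
        ≡⟨ ΣL-colourings-zero n (λ α → 𝟙 (relaxedColouring R [] α)) ⟩
      𝟙 ((nonemptyOn R empties ∧ disjointOnEdges empties) ∧ true)
        ≡⟨ cong 𝟙 (trans (Boolₚ.∧-identityʳ _) (cong₂ _∧_ (allB-cong (λ v → Boolₚ.∨-identityʳ (not (R v)))) no-edges)) ⟩
      𝟙 (allB (λ v → not (R v)) ∧ true)
        ≡⟨ cong 𝟙 (Boolₚ.∧-identityʳ _) ⟩
      𝟙 (allB (λ v → not (R v)))
        ≡⟨ ΣL-sign-covers n R ⟨
      ΣL (allSubsets n) (λ W → 𝟙 (covers W R) * sign W)
        ≡⟨ ℚSums.ΣL-cong (allSubsets n) (λ W → cong (𝟙 (covers W R) *_) (ℚₚ.*-identityʳ (sign W))) ⟨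
      inclusionExclusion R [] ∎
      where
      empties : Vec (Subset 0) n
      empties = Vec.replicate n []
      no-edges : disjointOnEdges empties ≡ true
      no-edges = trans (allB-cong (λ u → trans (allB-cong (λ v → Boolₚ.∨-zeroʳ (not (adj u v)))) (allB-true {n}))) (allB-true {n})
    relaxedCount≡inclusionExclusion {suc N} R (e₀ ∷ e) = begin
      relaxedCount R (e₀ ∷ e)
        ≡⟨ ΣL-colourings-suc n (λ α → 𝟙 (relaxedColouring R (e₀ ∷ e) α)) ⟩
      ΣL Ss (λ S → ΣL Cs (λ α → 𝟙 (relaxedColouring R (e₀ ∷ e) (Vec.zipWith _∷_ S α))))
        ≡⟨ ℚSums.ΣL-cong Ss (λ S → ℚSums.ΣL-cong Cs (λ α → cong 𝟙 (relaxedColouring-∷ S α R e₀ e))) ⟩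
      ΣL Ss (λ S → ΣL Cs (λ α → 𝟙 (firstClass S ∧ relaxedColouring (R minus S) e α)))
        ≡⟨ ℚSums.ΣL-cong Ss (λ S → trans (ΣL-𝟙-∧ Cs (firstClass S) _)
             (trans (cong (λ x → if firstClass S then x else 0ℚ) (relaxedCount≡inclusionExclusion (R minus S) e)) (if≡𝟙* (firstClass S) _))) ⟩
      ΣL Ss (λ S → 𝟙 (firstClass S) * inclusionExclusion (R minus S) e)
        ≡⟨ ℚSums.ΣL-cong Ss (λ S → trans (ℚSums.ΣL-*ˡ Ss (𝟙 (firstClass S)) _) (ℚSums.ΣL-cong Ss (regroup S))) ⟩
      ΣL Ss (λ S → ΣL Ss (λ W → X W * 𝟙 (subsetB G S W ∧ independentB G S ∧ (weightOf G S ≡ᵇ e₀))))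
        ≡⟨ ℚSums.ΣL-comm Ss Ss _ ⟩
      ΣL Ss (λ W → ΣL Ss (λ S → X W * 𝟙 (subsetB G S W ∧ independentB G S ∧ (weightOf G S ≡ᵇ e₀))))
        ≡⟨ ℚSums.ΣL-cong Ss (λ W → trans (cong (X W *_) (ℕtoℚ-countB _ Ss)) (ℚSums.ΣL-*ˡ Ss (X W) _)) ⟨
      ΣL Ss (λ W → X W * indep W e₀)
        ≡⟨ ℚSums.ΣL-cong Ss (λ W → solve 4 (λ c s p i → (c :* (s :* p)) :* i := c :* (s :* (i :* p))) refl
                                          (𝟙 (covers W R)) (sign W) (separable (indep W) e) (indep W e₀)) ⟩
      inclusionExclusion R (e₀ ∷ e) ∎
      where
      open +-*-Solver
      Ss = allSubsets n
      Cs = allVecs (allSubsets N) n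
      firstClass : Subset n → Bool
      firstClass S = independentB G S ∧ (weightOf G S ≡ᵇ e₀)
      X : Subset n → ℚ
      X W = 𝟙 (covers W R) * (sign W * separable (indep W) e)
      regroup : ∀ S W → 𝟙 (firstClass S) * (𝟙 (covers W (R minus S)) * (sign W * separable (indep W) e))
                        ≡ X W * 𝟙 (subsetB G S W ∧ independentB G S ∧ (weightOf G S ≡ᵇ e₀))
      regroup S W = begin
        𝟙 (firstClass S) * (𝟙 (covers W (R minus S)) * Y)
          ≡⟨ cong (λ z → 𝟙 (firstClass S) * (z * Y)) (trans (cong 𝟙 (covers-minus W S R)) (𝟙-∧ (covers W R) (subsetB G S W))) ⟩
        𝟙 (firstClass S) * ((𝟙 (covers W R) * 𝟙 (subsetB G S W)) * Y)
          ≡⟨ solve 4 (λ f c s y → f :* ((c :* s) :* y) := (c :* y) :* (s :* f)) refl (𝟙 (firstClass S)) (𝟙 (covers W R)) (𝟙 (subsetB G S W)) Y ⟩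
        X W * (𝟙 (subsetB G S W) * 𝟙 (firstClass S))
          ≡⟨ cong (X W *_) (𝟙-∧ (subsetB G S W) (firstClass S)) ⟨
        X W * 𝟙 (subsetB G S W ∧ firstClass S) ∎
        where Y = sign W * separable (indep W) e

    kromCoeff-inclusion-exclusion : ∀ {N} (e : Vec ℕ N) → ℕtoℚ (kromCoeff G e) ≡ ΣL (allSubsets n) (λ W → sign W * separable (indep W) e)
    kromCoeff-inclusion-exclusion {N} e = begin
      ℕtoℚ (kromCoeff G e)
        ≡⟨ ℕtoℚ-countB _ (allVecs (allSubsets N) n) ⟩
      relaxedCount (λ _ → true) e
        ≡⟨ relaxedCount≡inclusionExclusion (λ _ → true) e ⟩
      inclusionExclusion (λ _ → true) e
        ≡⟨ ℚSums.ΣL-cong (allSubsets n) (λ W → trans (cong (λ b → 𝟙 b * (sign W * separable (indep W) e)) (covers-everything W))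
                                                 (ℚₚ.*-identityˡ _)) ⟩
      ΣL (allSubsets n) (λ W → sign W * separable (indep W) e) ∎
      where
      covers-everything : ∀ W → covers W (λ _ → true) ≡ true
      covers-everything W = trans (allB-cong (λ v → Boolₚ.∨-zeroʳ (lookup W v))) (allB-true {n})

open SeparableSeries using (separable; separable-cong)
open PbarExpansion using (binomials; pbar-expansion)
open InclusionExclusion using (sign; indep; kromCoeff-inclusion-exclusion)

corollary1p2 : (G : WGraph) → (a : Subset (WGraph.n G) → ℕ → ℚ)
    → (∀ W m → prodBinCoeff (a W) m ≡ ℕtoℚ (indepCoeff G W m))
    → ∀ {N : ℕ} (e : Vec ℕ N)
    → ℕtoℚ (kromCoeff G e)
      ≡ sumℚ (map (λ lam → formula G a lam Q.* ℕtoℚ (pbarCoeff lam e))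
                  (partitionsUpTo (vsum e)))
corollary1p2 G a a-generates e = P.sym (begin
  ΣL Λ (λ λ′ → ΣL 𝒲 (λ W → sign G W Q.* binomials e (a W) λ′) Q.* p̄ λ′)
    ≡⟨ ℚSums.ΣL-cong Λ (λ λ′ → P.trans (ℚSums.ΣL-*ʳ 𝒲 (p̄ λ′) _) (ℚSums.ΣL-cong 𝒲 (λ W → ℚₚ.*-assoc (sign G W) _ (p̄ λ′)))) ⟩
  ΣL Λ (λ λ′ → ΣL 𝒲 (λ W → sign G W Q.* (binomials e (a W) λ′ Q.* p̄ λ′)))
    ≡⟨ ℚSums.ΣL-comm Λ 𝒲 _ ⟩
  ΣL 𝒲 (λ W → ΣL Λ (λ λ′ → sign G W Q.* (binomials e (a W) λ′ Q.* p̄ λ′)))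
    ≡⟨ ℚSums.ΣL-cong 𝒲 (λ W → ℚSums.ΣL-*ˡ Λ (sign G W) _) ⟨
  ΣL 𝒲 (λ W → sign G W Q.* ΣL Λ (λ λ′ → binomials e (a W) λ′ Q.* p̄ λ′))
    ≡⟨ ℚSums.ΣL-cong 𝒲 (λ W → P.cong (sign G W Q.*_) (P.trans (pbar-expansion e (a W)) (separable-cong (a-generates W) e))) ⟩
  ΣL 𝒲 (λ W → sign G W Q.* separable (indep G W) e)
    ≡⟨ kromCoeff-inclusion-exclusion G e ⟨
  ℕtoℚ (kromCoeff G e) ∎)
  where
  open P.≡-Reasoning
  open ℚSums using (ΣL)
  Λ = partitionsUpTo (vsum e)
  𝒲 = allSubsets (WGraph.n G)
  p̄ : Vec ℕ (vsum e) → ℚ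
  p̄ λ′ = ℕtoℚ (pbarCoeff λ′ e)
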